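{- Let $m,k$ be positive integers. Then \[ \mathcal J=\begin{cases}\frac23&\text{if }2\nmid mk,\\ \frac32&\text{if }2\mid m\text{ and }2\mid k,\\ 1&\text{if }2\mid mk\text{ but not both }m,k\text{ are even}.\end{cases} \]
   Context: For $v\ge0$ and $r\in\{0,1,4,5\}$, let $J_r(v)=\{1\le j\le2^{2v+3}:(j-mk)^2\equiv4k+4^vr\pmod{2^{2v+3}},\ jm\equiv0\pmod2\}$. Let $v_0=2$ if $m$ is odd and $v_0=3$ if $m$ is even, and \[ \mathcal J(v)=\frac{1}{2^{v_0-1}}\sum_{r\in\{0,1,4,5\}}\frac{|J_r(v)|}{2-\left(\frac r2\right)},\qquad \mathcal J=\sum_{\substack{v\ge0\\ (2^v,k)=1}}\frac{\mathcal J(v)}{8^v}, \] where $\left(\frac r2\right)$ is the Kronecker symbol at $2$: $\left(\frac02\right)=\left(\frac42\right)=0$, $\left(\frac12\right)=1$, $\left(\frac52\right)=-1$. -}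

module Defs where

open import Data.Bool using (Bool; true; false; if_then_else_; _∧_)
open import Data.Nat as ℕ using (ℕ; zero; suc; _^_; _≤_)
open import Data.Nat.Properties using (m^n≢0)
open import Data.Nat.Coprimality using (coprime?)
open import Data.Integer as ℤ using (ℤ; +_)
open import Data.Integer.DivMod using (_%ℕ_)
open import Data.Rational as ℚ using (ℚ; 0ℚ; _/_; ∣_∣)
open import Relation.Nullary using (does)
open import Relation.Binary.PropositionalEquality using (_≡_)
open import Data.Product using (Σ; ∃; _×_)

congPow2 : ℕ → ℤ → ℤ → Bool
congPow2 e a b = does (((a ℤ.- b) %ℕ (2 ^ e)) {{m^n≢0 2 e}} ℕ.≟ 0)

-- number of j in {1,…,n} with f j = true
countUpTo : (ℕ → Bool) → ℕ → ℕ
countUpTo f zero    = 0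
countUpTo f (suc n) = countUpTo f n ℕ.+ (if f (suc n) then 1 else 0)

Jcard : (m k v r : ℕ) → ℕ
Jcard m k v r = countUpTo cond (2 ^ (2 ℕ.* v ℕ.+ 3))
  where
    cond : ℕ → Bool
    cond j = congPow2 (2 ℕ.* v ℕ.+ 3)
               (((+ j) ℤ.- (+ (m ℕ.* k))) ℤ.* ((+ j) ℤ.- (+ (m ℕ.* k))))
               ((+ (4 ℕ.* k)) ℤ.+ (+ (4 ^ v ℕ.* r)))
             ∧ does ((j ℕ.* m) ℕ.% 2 ℕ.≟ 0)

-- v₀ = 2 if m odd, 3 if m even; this is 2^(v₀-1)
twoPowV0m1 : ℕ → ℕ
twoPowV0m1 m = if does ((m ℕ.% 2) ℕ.≟ 0) then 4 else 2

-- 𝒥(v) = 2^{-(v₀-1)} Σ_{r∈{0,1,4,5}} |J_r(v)| / (2 - (r/2)),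
-- with 2-(0/2)=2, 2-(1/2)=1, 2-(4/2)=2, 2-(5/2)=3
calJ : (m k v : ℕ) → ℚ
calJ m k v =
  (((+ Jcard m k v 0) / 2) ℚ.+ ((+ Jcard m k v 1) / 1)
    ℚ.+ ((+ Jcard m k v 4) / 2) ℚ.+ ((+ Jcard m k v 5) / 3))
  ℚ.* (ℤ.+ 1 / twoPowV0m1 m) {{nz m}}
  where
    nz : ∀ m → ℕ.NonZero (twoPowV0m1 m)
    nz m with does ((m ℕ.% 2) ℕ.≟ 0)
    ... | true  = _
    ... | false = _

calJTerm : (m k v : ℕ) → ℚ
calJTerm m k v =
  if does (coprime? (2 ^ v) k)
  then calJ m k v ℚ.* ((+ 1 / (8 ^ v)) {{m^n≢0 8 v}})
  else 0ℚ

partialSum : (ℕ → ℚ) → ℕ → ℚ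
partialSum a zero    = 0ℚ
partialSum a (suc n) = partialSum a n ℚ.+ a n

SeriesSumsTo : (ℕ → ℚ) → ℚ → Set
SeriesSumsTo a s =
  (ε : ℚ) → 0ℚ ℚ.< ε → ∃ λ N → (n : ℕ) → N ≤ n → ∣ partialSum a n ℚ.- s ∣ ℚ.< ε

module Submission where

-- Substituting j = m k + x, |J_r(v)| counts the x ≤ 2^(2v+3) with x² ≡ 4k + 4^v r (mod 2^(2v+3)) and,
-- when m is odd, x ≡ k (mod 2); so it depends only on m mod 2 and k mod 2^(2v+1).  If m and k are odd,
-- x must be odd for v ≥ 1 while 4k + 4^v r is even, so only v = 0 contributes; if k is even, the
-- coprimality condition kills every v ≥ 1.  In these cases the series is its v = 0 term, which is
-- computed.  If m is even and k odd, the terms v ≤ 2 depend only on k mod 32 and are computed, while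
-- for v ≥ 3 the congruence is x² ≡ 4b (mod 2^(2v+3)) with b ≡ k (mod 8).  It has no solution unless
-- b ≡ 1 (mod 8), and then exactly 8: x ≡ ±2y (mod 2^(2v+1)) for a 2-adic square root y of b, which
-- exists by Hensel lifting.  The tail is then the geometric series Σ_{v ≥ 3} (14/3) 8^(-v) = 1/96.

module Counting where

  open import Defs
  open import Data.Bool using (Bool; true; false; if_then_else_; _∨_)
  open import Data.Empty using (⊥)
  open import Data.Nat using (ℕ; zero; suc; _+_; _*_; _<_)
  open import Data.Nat.Properties
    using (+-identityʳ; +-suc; +-assoc; +-comm; +-cancelˡ-≡; +-commutativeSemigroup; ≤-refl; m≤n⇒m≤1+n)
  open import Algebra.Properties.CommutativeSemigroup +-commutativeSemigroup using (interchange)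
  open import Data.Nat.Tactic.RingSolver using (solve-∀)
  open import Relation.Binary.PropositionalEquality using (_≡_; refl; sym; trans; cong; cong₂; module ≡-Reasoning)
  open ≡-Reasoning

  indicator : Bool → ℕ
  indicator b = if b then 1 else 0

  Periodic : ℕ → (ℕ → Bool) → Set
  Periodic Q f = ∀ x → f (Q + x) ≡ f x

  countUpTo-cong : ∀ {f g} n → (∀ j → j < n → f (suc j) ≡ g (suc j)) → countUpTo f n ≡ countUpTo g n
  countUpTo-cong zero    eq = refl
  countUpTo-cong (suc n) eq =
    cong₂ _+_ (countUpTo-cong n (λ j j<n → eq j (m≤n⇒m≤1+n j<n))) (cong indicator (eq n ≤-refl))

  countUpTo-false : ∀ {f} n → (∀ j → j < n → f (suc j) ≡ false) → countUpTo f n ≡ 0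
  countUpTo-false n never = trans (countUpTo-cong n never) (count-false n)
    where
    count-false : ∀ n → countUpTo (λ _ → false) n ≡ 0
    count-false zero    = refl
    count-false (suc n) = trans (+-identityʳ _) (count-false n)

  countUpTo-+ : ∀ f a b → countUpTo f (a + b) ≡ countUpTo f a + countUpTo (λ x → f (a + x)) b
  countUpTo-+ f a zero    = trans (cong (countUpTo f) (+-identityʳ a)) (sym (+-identityʳ _))
  countUpTo-+ f a (suc b) = begin
    countUpTo f (a + suc b)                                     ≡⟨ cong (countUpTo f) (+-suc a b) ⟩
    countUpTo f (a + b) + indicator (f (suc (a + b)))           ≡⟨ cong (_+ indicator (f (suc (a + b)))) (countUpTo-+ f a b) ⟩
    countUpTo f a + countUpTo fₐ b + indicator (f (suc (a + b))) ≡⟨ +-assoc (countUpTo f a) _ _ ⟩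
    countUpTo f a + (countUpTo fₐ b + indicator (f (suc (a + b)))) ≡⟨ cong (λ y → countUpTo f a + (countUpTo fₐ b + indicator (f y))) (sym (+-suc a b)) ⟩
    countUpTo f a + countUpTo fₐ (suc b)                        ∎
    where fₐ = λ x → f (a + x)

  countUpTo-shift : ∀ {f} Q → Periodic Q f → ∀ s → countUpTo (λ x → f (s + x)) Q ≡ countUpTo f Q
  countUpTo-shift Q per zero    = refl
  countUpTo-shift {f} Q per (suc s) = begin
    countUpTo (λ x → f (suc s + x)) Q ≡⟨ countUpTo-cong Q (λ j _ → cong f (sym (+-suc s (suc j)))) ⟩
    countUpTo (λ x → g (suc x)) Q     ≡⟨ rotate ⟩
    countUpTo g Q                     ≡⟨ countUpTo-shift Q per s ⟩
    countUpTo f Q                     ∎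
    where
    g = λ x → f (s + x)
    g-periodic : g (suc Q) ≡ g 1
    g-periodic = trans (cong f (reassoc s Q)) (per (s + 1))
      where
      reassoc : ∀ s Q → s + suc Q ≡ Q + (s + 1)
      reassoc = solve-∀
    rotate : countUpTo (λ x → g (suc x)) Q ≡ countUpTo g Q
    rotate = +-cancelˡ-≡ (indicator (g 1)) _ _ (begin
      indicator (g 1) + countUpTo (λ x → g (suc x)) Q ≡⟨ countUpTo-+ g 1 Q ⟨
      countUpTo g Q + indicator (g (suc Q))           ≡⟨ cong (λ b → countUpTo g Q + indicator b) g-periodic ⟩
      countUpTo g Q + indicator (g 1)                 ≡⟨ +-comm (countUpTo g Q) _ ⟩
      indicator (g 1) + countUpTo g Q                 ∎)

  countUpTo-* : ∀ {f} Q → Periodic Q f → ∀ q → countUpTo f (q * Q) ≡ q * countUpTo f Q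
  countUpTo-* Q per zero    = refl
  countUpTo-* {f} Q per (suc q) = begin
    countUpTo f (Q + q * Q)                             ≡⟨ countUpTo-+ f Q (q * Q) ⟩
    countUpTo f Q + countUpTo (λ x → f (Q + x)) (q * Q) ≡⟨ cong (countUpTo f Q +_) (countUpTo-cong (q * Q) (λ j _ → per (suc j))) ⟩
    countUpTo f Q + countUpTo f (q * Q)                 ≡⟨ cong (countUpTo f Q +_) (countUpTo-* Q per q) ⟩
    countUpTo f Q + q * countUpTo f Q                   ∎

  countUpTo-∨ : ∀ {g h} n → (∀ j → g j ≡ true → h j ≡ true → ⊥) →
                countUpTo (λ j → g j ∨ h j) n ≡ countUpTo g n + countUpTo h n
  countUpTo-∨ zero    disjoint = refl
  countUpTo-∨ {g} {h} (suc n) disjoint = begin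
    countUpTo (λ j → g j ∨ h j) n + indicator (g (suc n) ∨ h (suc n))
      ≡⟨ cong₂ _+_ (countUpTo-∨ n disjoint) (indicator-∨ (g (suc n)) (h (suc n)) (disjoint (suc n))) ⟩
    (countUpTo g n + countUpTo h n) + (indicator (g (suc n)) + indicator (h (suc n)))
      ≡⟨ interchange (countUpTo g n) _ _ _ ⟩
    countUpTo g (suc n) + countUpTo h (suc n) ∎
    where
    indicator-∨ : ∀ a b → (a ≡ true → b ≡ true → ⊥) → indicator (a ∨ b) ≡ indicator a + indicator b
    indicator-∨ true  true  disj with () ← disj refl refl
    indicator-∨ true  false _ = refl
    indicator-∨ false b     _ = refl

module Congruences where

  open import Defs
  open import Data.Bool using (true; false)
  open import Data.Empty using (⊥-elim)
  open import Data.Nat as ℕ using (ℕ; zero; suc; _^_; NonZero)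
  import Data.Nat.Properties as ℕ
  import Data.Nat.DivMod as ℕ
  import Data.Nat.Divisibility as ℕ
  open import Data.Nat.Coprimality using (Coprime; 1-coprimeTo; coprime-factors)
  open import Data.Nat.Primality using (prime[2]; prime⇒irreducible)
  open import Data.Integer using (ℤ; +_; -[1+_]; _+_; _*_; _-_; -_; ∣_∣)
  import Data.Integer.Properties as ℤ
  open import Data.Integer.DivMod using (_%ℕ_; _/ℕ_; a≡a%ℕn+[a/ℕn]*n; n%ℕd<d)
  open import Data.Integer.Divisibility.Signed
    using (_∣_; _∣?_; divides; ∣ᵤ⇒∣; ∣⇒∣ᵤ; ∣-trans; ∣m∣n⇒∣m-n; ∣m∣n⇒∣m+n; ∣m+n∣m⇒∣n; *-monoʳ-∣; *-cancelˡ-∣)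
  import Data.Integer.Coprimality as ℤ using (coprime-divisor)
  open import Data.Integer.Tactic.RingSolver using (solve-∀)
  open import Data.Product using (_,_)
  open import Data.Sum using (_⊎_; inj₁; inj₂; [_,_]′)
  open import Function using (_⇔_; mk⇔; id)
  open import Relation.Nullary using (¬_; Dec; does; yes)
  open import Relation.Nullary.Decidable using (does-⇔; dec-true; dec-false)
  open import Relation.Binary.PropositionalEquality using (_≡_; refl; sym; trans; cong; cong₂; subst; module ≡-Reasoning)

  2^-coprime : ∀ {n} → ¬ 2 ℕ.∣ n → ∀ i → Coprime (2 ^ i) n
  2^-coprime {n} 2∤n zero    = 1-coprimeTo n
  2^-coprime {n} 2∤n (suc i) (d∣2^[1+i] , d∣n) =
    2^-coprime 2∤n i (coprime-factors coprime[2,n] (d∣2^[1+i] , ℕ.∣m⇒∣m*n (2 ^ i) d∣n) , d∣n)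
    where
    coprime[2,n] : Coprime 2 n
    coprime[2,n] (d∣2 , d∣n) = [ id , (λ { refl → ⊥-elim (2∤n d∣n) }) ]′ (prime⇒irreducible prime[2] d∣2)

  %2≡0⊎%2≡1 : ∀ n → n ℕ.% 2 ≡ 0 ⊎ n ℕ.% 2 ≡ 1
  %2≡0⊎%2≡1 n with n ℕ.% 2 | ℕ.m%n<n n 2
  ... | 0           | _                 = inj₁ refl
  ... | 1           | _                 = inj₂ refl
  ... | suc (suc _) | ℕ.s≤s (ℕ.s≤s ())

  %2≡1⇒2∤ : ∀ {n} → n ℕ.% 2 ≡ 1 → ¬ 2 ℕ.∣ n
  %2≡1⇒2∤ {n} n%2≡1 2∣n with () ← trans (sym n%2≡1) (ℕ.n∣m⇒m%n≡0 n 2 2∣n)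

  2∤⇒%2≡1 : ∀ {n} → ¬ 2 ℕ.∣ n → n ℕ.% 2 ≡ 1
  2∤⇒%2≡1 {n} 2∤n = [ (λ n%2≡0 → ⊥-elim (2∤n (ℕ.m%n≡0⇒n∣m n 2 n%2≡0))) , id ]′ (%2≡0⊎%2≡1 n)

  2^ᶻ_ : ℕ → ℤ
  2^ᶻ e = + (2 ^ e)

  2^ᶻ-suc : ∀ e → 2^ᶻ suc e ≡ + 2 * 2^ᶻ e
  2^ᶻ-suc e = ℤ.pos-* 2 (2 ^ e)

  2^ᶻ-+ : ∀ i j → 2^ᶻ (i ℕ.+ j) ≡ 2^ᶻ i * 2^ᶻ j
  2^ᶻ-+ i j = trans (cong +_ (ℕ.^-distribˡ-+-* 2 i j)) (ℤ.pos-* (2 ^ i) (2 ^ j))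

  2^ᶻ-∣-weaken : ∀ i j {z} → 2^ᶻ (i ℕ.+ j) ∣ z → 2^ᶻ i ∣ z
  2^ᶻ-∣-weaken i j = ∣-trans (divides (2^ᶻ j) (trans (2^ᶻ-+ i j) (ℤ.*-comm (2^ᶻ i) (2^ᶻ j))))

  2^ᶻ-∣-*2 : ∀ e {z} → 2^ᶻ e ∣ z → 2^ᶻ suc e ∣ + 2 * z
  2^ᶻ-∣-*2 e {z} p = subst (_∣ + 2 * z) (sym (2^ᶻ-suc e)) (*-monoʳ-∣ (+ 2) p)

  2^ᶻ-∣-/2 : ∀ e {z} → 2^ᶻ suc e ∣ + 2 * z → 2^ᶻ e ∣ z
  2^ᶻ-∣-/2 e {z} p = *-cancelˡ-∣ (+ 2) (subst (_∣ + 2 * z) (2^ᶻ-suc e) p)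

  %≡%⇒∣- : ∀ {M} .{{_ : NonZero M}} k k′ → k ℕ.% M ≡ k′ ℕ.% M → + M ∣ + k - + k′
  %≡%⇒∣- {M} k k′ eq = divides (+ (k ℕ./ M) - + (k′ ℕ./ M)) (begin
    + k - + k′
      ≡⟨ cong₂ (λ a b → + a - + b) (ℕ.m≡m%n+[m/n]*n k M) (ℕ.m≡m%n+[m/n]*n k′ M) ⟩
    + (k ℕ.% M ℕ.+ k ℕ./ M ℕ.* M) - + (k′ ℕ.% M ℕ.+ k′ ℕ./ M ℕ.* M)
      ≡⟨ cong (λ r → + (r ℕ.+ k ℕ./ M ℕ.* M) - + (k′ ℕ.% M ℕ.+ k′ ℕ./ M ℕ.* M)) eq ⟩
    + (k′ ℕ.% M ℕ.+ k ℕ./ M ℕ.* M) - + (k′ ℕ.% M ℕ.+ k′ ℕ./ M ℕ.* M)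
      ≡⟨ cong₂ _-_ (embed (k′ ℕ.% M) (k ℕ./ M)) (embed (k′ ℕ.% M) (k′ ℕ./ M)) ⟩
    (+ (k′ ℕ.% M) + + (k ℕ./ M) * + M) - (+ (k′ ℕ.% M) + + (k′ ℕ./ M) * + M)
      ≡⟨ cancel (+ (k′ ℕ.% M)) (+ (k ℕ./ M)) (+ (k′ ℕ./ M)) (+ M) ⟩
    (+ (k ℕ./ M) - + (k′ ℕ./ M)) * + M ∎)
    where
    open ≡-Reasoning
    embed : ∀ r q → + (r ℕ.+ q ℕ.* M) ≡ + r + + q * + M
    embed r q = trans (ℤ.pos-+ r (q ℕ.* M)) (cong (_+_ (+ r)) (ℤ.pos-* q M))
    cancel : ∀ r q q′ M → (r + q * M) - (r + q′ * M) ≡ (q - q′) * M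
    cancel = solve-∀

  ∣-⇒%≡% : ∀ {M} .{{_ : NonZero M}} k k′ → + M ∣ + k - + k′ → k ℕ.% M ≡ k′ ℕ.% M
  ∣-⇒%≡% {M} k k′ (divides (+ q) eq) = trans (cong (ℕ._% M) (ℤ.+-injective (begin
    + k                       ≡⟨ move (+ k) (+ k′) ⟩
    (+ k - + k′) + + k′       ≡⟨ cong (_+ + k′) eq ⟩
    + q * + M + + k′          ≡⟨ ℤ.+-comm (+ q * + M) (+ k′) ⟩
    + k′ + + q * + M          ≡⟨ cong (_+_ (+ k′)) (ℤ.pos-* q M) ⟨
    + k′ + + (q ℕ.* M)        ≡⟨ ℤ.pos-+ k′ (q ℕ.* M) ⟨
    + (k′ ℕ.+ q ℕ.* M)        ∎))) (ℕ.[m+kn]%n≡m%n k′ q M)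
    where
    open ≡-Reasoning
    move : ∀ a b → a ≡ (a - b) + b
    move = solve-∀
  ∣-⇒%≡% {M} k k′ (divides -[1+ q ] eq) = sym (∣-⇒%≡% k′ k (divides (+ suc q) (begin
    + k′ - + k                ≡⟨ flip (+ k) (+ k′) ⟩
    - (+ k - + k′)            ≡⟨ cong -_ eq ⟩
    - (-[1+ q ] * + M)        ≡⟨ ℤ.neg-distribˡ-* -[1+ q ] (+ M) ⟩
    + suc q * + M             ∎)))
    where
    open ≡-Reasoning
    flip : ∀ a b → b - a ≡ - (a - b)
    flip = solve-∀

  %ℕ≡0⇔∣ : ∀ z d .{{_ : NonZero d}} → z %ℕ d ≡ 0 ⇔ + d ∣ z
  %ℕ≡0⇔∣ z d = mk⇔ to (from z)
    where
    open ≡-Reasoning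
    to : z %ℕ d ≡ 0 → + d ∣ z
    to eq = divides (z /ℕ d) (begin
      z                            ≡⟨ a≡a%ℕn+[a/ℕn]*n z d ⟩
      + (z %ℕ d) + (z /ℕ d) * + d  ≡⟨ cong (λ r → + r + (z /ℕ d) * + d) eq ⟩
      + 0 + (z /ℕ d) * + d         ≡⟨ ℤ.+-identityˡ _ ⟩
      (z /ℕ d) * + d               ∎)
    from : ∀ z → + d ∣ z → z %ℕ d ≡ 0
    from (+ n)    d∣z = ℕ.n∣m⇒m%n≡0 n d (∣⇒∣ᵤ d∣z)
    from -[1+ n ] d∣z with suc n ℕ.% d in eq
    ... | zero  = refl
    ... | suc _ with () ← trans (sym eq) (ℕ.n∣m⇒m%n≡0 (suc n) d (∣⇒∣ᵤ d∣z))

  congPow2≡does∣ : ∀ e a b → congPow2 e a b ≡ does (2^ᶻ e ∣? (a - b))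
  congPow2≡does∣ e a b = does-⇔ (%ℕ≡0⇔∣ (a - b) (2 ^ e) {{ℕ.m^n≢0 2 e}}) (((a - b) %ℕ 2 ^ e) {{ℕ.m^n≢0 2 e}} ℕ.≟ 0) (2^ᶻ e ∣? (a - b))

  congPow2⇒∣ : ∀ e a b → congPow2 e a b ≡ true → 2^ᶻ e ∣ a - b
  congPow2⇒∣ e a b h = does≡true⇒ (2^ᶻ e ∣? (a - b)) (trans (sym (congPow2≡does∣ e a b)) h)
    where
    does≡true⇒ : ∀ {A : Set} (a? : Dec A) → does a? ≡ true → A
    does≡true⇒ (yes a) _ = a

  ∣⇒congPow2 : ∀ e a b → 2^ᶻ e ∣ a - b → congPow2 e a b ≡ true
  ∣⇒congPow2 e a b p = trans (congPow2≡does∣ e a b) (dec-true (2^ᶻ e ∣? (a - b)) p)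

  ∤⇒congPow2 : ∀ e a b → ¬ 2^ᶻ e ∣ a - b → congPow2 e a b ≡ false
  ∤⇒congPow2 e a b ¬p = trans (congPow2≡does∣ e a b) (dec-false (2^ᶻ e ∣? (a - b)) ¬p)

  congPow2-cong : ∀ e a b a′ b′ → 2^ᶻ e ∣ (a - b) - (a′ - b′) → congPow2 e a b ≡ congPow2 e a′ b′
  congPow2-cong e a b a′ b′ p = begin
    congPow2 e a b                    ≡⟨ congPow2≡does∣ e a b ⟩
    does (2^ᶻ e ∣? (a - b))           ≡⟨ does-⇔ (mk⇔ to from) (2^ᶻ e ∣? (a - b)) (2^ᶻ e ∣? (a′ - b′)) ⟩
    does (2^ᶻ e ∣? (a′ - b′))         ≡⟨ congPow2≡does∣ e a′ b′ ⟨
    congPow2 e a′ b′                  ∎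
    where
    open ≡-Reasoning
    to : 2^ᶻ e ∣ a - b → 2^ᶻ e ∣ a′ - b′
    to q = subst (2^ᶻ e ∣_) (diff a b a′ b′) (∣m∣n⇒∣m-n q p)
      where diff : ∀ a b a′ b′ → (a - b) - ((a - b) - (a′ - b′)) ≡ a′ - b′
            diff = solve-∀
    from : 2^ᶻ e ∣ a′ - b′ → 2^ᶻ e ∣ a - b
    from q = subst (2^ᶻ e ∣_) (diff a b a′ b′) (∣m∣n⇒∣m+n p q)
      where diff : ∀ a b a′ b′ → ((a - b) - (a′ - b′)) + (a′ - b′) ≡ a - b
            diff = solve-∀

  data Parity : ℤ → Set where
    even : ∀ t → Parity (+ 2 * t)
    odd  : ∀ t → Parity (+ 2 * t + + 1)

  parity : ∀ z → Parity z
  parity z with z %ℕ 2 | n%ℕd<d z 2 | a≡a%ℕn+[a/ℕn]*n z 2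
  ... | 0 | _ | eq rewrite eq | ℤ.+-identityˡ ((z /ℕ 2) * + 2) | ℤ.*-comm (z /ℕ 2) (+ 2) = even (z /ℕ 2)
  ... | 1 | _ | eq rewrite eq | ℤ.+-comm (+ 1) ((z /ℕ 2) * + 2) | ℤ.*-comm (z /ℕ 2) (+ 2) = odd (z /ℕ 2)
  ... | suc (suc _) | ℕ.s≤s (ℕ.s≤s ()) | _

  odd-∤ : ∀ t → ¬ (+ 2 ∣ + 2 * t + + 1)
  odd-∤ t 2∣odd with () ← ℕ.∣1⇒≡1 (∣⇒∣ᵤ (∣m+n∣m⇒∣n 2∣odd (divides t (ℤ.*-comm (+ 2) t))))

  ∣-odd-cancel : ∀ i t {z} → 2^ᶻ i ∣ (+ 2 * t + + 1) * z → 2^ᶻ i ∣ z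
  ∣-odd-cancel i t {z} p = ∣ᵤ⇒∣ (ℤ.coprime-divisor (2^ᶻ i) (+ 2 * t + + 1) z (2^-coprime 2∤∣odd∣ i) (∣⇒∣ᵤ p))
    where
    2∤∣odd∣ : ¬ 2 ℕ.∣ ∣ + 2 * t + + 1 ∣
    2∤∣odd∣ 2∣ = odd-∤ t (∣ᵤ⇒∣ 2∣)

module SquareRoots where

  open import Defs
  open Counting
  open Congruences
  open import Data.Bool as Bool using (Bool; true; false; _∨_)
  open import Data.Empty using (⊥; ⊥-elim)
  open import Data.Nat as ℕ using (ℕ; zero; suc; _^_; NonZero)
  import Data.Nat.Properties as ℕ
  import Data.Nat.Divisibility as ℕ
  import Data.Nat.DivMod as ℕ
  open import Data.Integer using (ℤ; +_; _+_; _*_; _-_; -_)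
  import Data.Integer.Properties as ℤ
  open import Data.Integer.DivMod using (_%ℕ_; _/ℕ_; a≡a%ℕn+[a/ℕn]*n)
  open import Data.Integer.Divisibility.Signed
    using (_∣_; divides; ∣m∣n⇒∣m-n; ∣m⇒∣-m; ∣m⇒∣m*n; *-monoʳ-∣; ∣⇒∣ᵤ)
  open import Data.Integer.Tactic.RingSolver using (solve-∀)
  open import Data.Product using (∃; _,_; proj₁; proj₂)
  open import Data.Sum using (_⊎_; inj₁; inj₂; map; [_,_])
  open import Relation.Nullary using (¬_; _→-dec_)
  open import Relation.Nullary.Decidable using (toWitness)
  open import Relation.Binary.PropositionalEquality
    using (_≡_; _≢_; refl; sym; trans; cong; cong₂; subst; module ≡-Reasoning)
  open ≡-Reasoning

  ∃-odd-sqrt : ∀ {b} → 2^ᶻ 3 ∣ b - + 1 → ∀ n → ∃ λ t → 2^ᶻ (3 ℕ.+ n) ∣ (+ 2 * t + + 1) * (+ 2 * t + + 1) - b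
  ∃-odd-sqrt {b} b≡1 zero = + 0 , subst (2^ᶻ 3 ∣_) (flip b) (∣m⇒∣-m b≡1)
    where flip : ∀ b → - (b - + 1) ≡ (+ 2 * + 0 + + 1) * (+ 2 * + 0 + + 1) - b
          flip = solve-∀
  ∃-odd-sqrt {b} b≡1 (suc n) with ∃-odd-sqrt b≡1 n
  ... | t , divides q eq with parity q
  ...   | even s = t , divides s (begin
    (+ 2 * t + + 1) * (+ 2 * t + + 1) - b ≡⟨ eq ⟩
    (+ 2 * s) * 2^ᶻ (3 ℕ.+ n)             ≡⟨ swap s (2^ᶻ (3 ℕ.+ n)) ⟩
    s * (+ 2 * 2^ᶻ (3 ℕ.+ n))             ≡⟨ cong (s *_) (2^ᶻ-suc (3 ℕ.+ n)) ⟨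
    s * 2^ᶻ (4 ℕ.+ n)                     ∎)
    where swap : ∀ s X → (+ 2 * s) * X ≡ s * (+ 2 * X)
          swap = solve-∀
  -- An odd quotient is absorbed by y ↦ y + 2^(n+2), as (y + 2^(n+2))² ≡ y² + 2^(n+3) y (mod 2^(n+4)).
  ...   | odd s = t + + 2 * P , divides (s + t + + 1 + P) (begin
    (+ 2 * (t + + 2 * P) + + 1) * (+ 2 * (t + + 2 * P) + + 1) - b
      ≡⟨ expand t P b ⟩
    ((+ 2 * t + + 1) * (+ 2 * t + + 1) - b) + + 8 * P * (+ 2 * t + + 1) + + 16 * (P * P)
      ≡⟨ cong (λ d → d + + 8 * P * (+ 2 * t + + 1) + + 16 * (P * P)) (trans eq (cong ((+ 2 * s + + 1) *_) (2^ᶻ-+ 3 n))) ⟩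
    (+ 2 * s + + 1) * (+ 8 * P) + + 8 * P * (+ 2 * t + + 1) + + 16 * (P * P)
      ≡⟨ collect s t P ⟩
    (s + t + + 1 + P) * (+ 16 * P)
      ≡⟨ cong ((s + t + + 1 + P) *_) (2^ᶻ-+ 4 n) ⟨
    (s + t + + 1 + P) * 2^ᶻ (4 ℕ.+ n) ∎)
    where
    P = 2^ᶻ n
    expand : ∀ t P b → (+ 2 * (t + + 2 * P) + + 1) * (+ 2 * (t + + 2 * P) + + 1) - b
                     ≡ ((+ 2 * t + + 1) * (+ 2 * t + + 1) - b) + + 8 * P * (+ 2 * t + + 1) + + 16 * (P * P)
    expand = solve-∀
    collect : ∀ s t P → (+ 2 * s + + 1) * (+ 8 * P) + + 8 * P * (+ 2 * t + + 1) + + 16 * (P * P)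
                      ≡ (s + t + + 1 + P) * (+ 16 * P)
    collect = solve-∀

  -- One of a, c is odd since a + c is, and an odd factor can be cancelled.
  ∣*-odd-sum : ∀ n a c → 2^ᶻ n ∣ a * c → ¬ (+ 2 ∣ a + c) → 2^ᶻ n ∣ a ⊎ 2^ᶻ n ∣ c
  ∣*-odd-sum n a c p a+c-odd with parity a | parity c
  ... | odd s  | _      = inj₂ (∣-odd-cancel n s p)
  ... | even _ | odd s  = inj₁ (∣-odd-cancel n s (subst (2^ᶻ n ∣_) (ℤ.*-comm _ (+ 2 * s + + 1)) p))
  ... | even w | even s = ⊥-elim (a+c-odd (divides (w + s) (sum w s)))
    where sum : ∀ w s → + 2 * w + + 2 * s ≡ (w + s) * + 2
          sum = solve-∀

  sq≡sq⇒≡± : ∀ n y z → ¬ (+ 2 ∣ y) → 2^ᶻ (2 ℕ.+ n) ∣ z * z - y * y →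
             2^ᶻ (1 ℕ.+ n) ∣ z - y ⊎ 2^ᶻ (1 ℕ.+ n) ∣ z + y
  sq≡sq⇒≡± n y z y-odd p with parity y | parity z
  ... | even t | _      = ⊥-elim (y-odd (divides t (ℤ.*-comm (+ 2) t)))
  ... | odd t  | even u = ⊥-elim (odd-∤ (+ 2 * u * u - + 2 * t * t - + 2 * t - + 1) (subst (+ 2 ∣_) (diff u t) (2^ᶻ-∣-weaken 1 (1 ℕ.+ n) p)))
    where diff : ∀ u t → + 2 * u * (+ 2 * u) - (+ 2 * t + + 1) * (+ 2 * t + + 1)
                       ≡ + 2 * (+ 2 * u * u - + 2 * t * t - + 2 * t - + 1) + + 1
          diff = solve-∀
  ... | odd t  | odd u  = map (λ p₋ → subst (2^ᶻ (1 ℕ.+ n) ∣_) (diff u t) (2^ᶻ-∣-*2 n p₋))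
                              (λ p₊ → subst (2^ᶻ (1 ℕ.+ n) ∣_) (sum′ u t) (2^ᶻ-∣-*2 n p₊))
                              (∣*-odd-sum n (u - t) (u + t + + 1) 2^n∣product (λ 2∣sum → odd-∤ u (subst (+ 2 ∣_) (sum u t) 2∣sum)))
    where
    factor : ∀ u t → (+ 2 * u + + 1) * (+ 2 * u + + 1) - (+ 2 * t + + 1) * (+ 2 * t + + 1)
                   ≡ + 2 * (+ 2 * ((u - t) * (u + t + + 1)))
    factor = solve-∀
    2^n∣product : 2^ᶻ n ∣ (u - t) * (u + t + + 1)
    2^n∣product = 2^ᶻ-∣-/2 n (2^ᶻ-∣-/2 (1 ℕ.+ n) (subst (2^ᶻ (2 ℕ.+ n) ∣_) (factor u t) p))
    sum : ∀ u t → (u - t) + (u + t + + 1) ≡ + 2 * u + + 1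
    sum = solve-∀
    diff : ∀ u t → + 2 * (u - t) ≡ (+ 2 * u + + 1) - (+ 2 * t + + 1)
    diff = solve-∀
    sum′ : ∀ u t → + 2 * (u + t + + 1) ≡ (+ 2 * u + + 1) + (+ 2 * t + + 1)
    sum′ = solve-∀

  ≡2y⇒sq≡4b : ∀ n b y x → 2^ᶻ (2 ℕ.+ n) ∣ y * y - b → 2^ᶻ (2 ℕ.+ n) ∣ x - + 2 * y →
              2^ᶻ (4 ℕ.+ n) ∣ x * x - + 4 * b
  ≡2y⇒sq≡4b n b y x (divides q y²≡b) (divides u x≡2y) = divides (q + y * u + P * (u * u)) (begin
    x * x - + 4 * b
      ≡⟨ expand x y b ⟩
    + 4 * (y * y - b) + + 4 * y * (x - + 2 * y) + (x - + 2 * y) * (x - + 2 * y)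
      ≡⟨ cong₂ (λ d e → + 4 * d + + 4 * y * e + e * e) (trans y²≡b (cong (q *_) (2^ᶻ-+ 2 n))) (trans x≡2y (cong (u *_) (2^ᶻ-+ 2 n))) ⟩
    + 4 * (q * (+ 4 * P)) + + 4 * y * (u * (+ 4 * P)) + u * (+ 4 * P) * (u * (+ 4 * P))
      ≡⟨ collect q y u P ⟩
    (q + y * u + P * (u * u)) * (+ 16 * P)
      ≡⟨ cong ((q + y * u + P * (u * u)) *_) (2^ᶻ-+ 4 n) ⟨
    (q + y * u + P * (u * u)) * 2^ᶻ (4 ℕ.+ n) ∎)
    where
    P = 2^ᶻ n
    expand : ∀ x y b → x * x - + 4 * b ≡ + 4 * (y * y - b) + + 4 * y * (x - + 2 * y) + (x - + 2 * y) * (x - + 2 * y)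
    expand = solve-∀
    collect : ∀ q y u P → + 4 * (q * (+ 4 * P)) + + 4 * y * (u * (+ 4 * P)) + u * (+ 4 * P) * (u * (+ 4 * P))
                        ≡ (q + y * u + P * (u * u)) * (+ 16 * P)
    collect = solve-∀

  sq≡4b⇒≡±2y : ∀ n b y x → ¬ (+ 2 ∣ y) → 2^ᶻ (2 ℕ.+ n) ∣ y * y - b → 2^ᶻ (4 ℕ.+ n) ∣ x * x - + 4 * b →
               2^ᶻ (2 ℕ.+ n) ∣ x - + 2 * y ⊎ 2^ᶻ (2 ℕ.+ n) ∣ x + + 2 * y
  sq≡4b⇒≡±2y n b y x y-odd y²≡b x²≡4b with parity x
  ... | odd s  = ⊥-elim (odd-∤ (+ 2 * s * s + + 2 * s - + 2 * b) (subst (+ 2 ∣_) (diff s b) (2^ᶻ-∣-weaken 1 (3 ℕ.+ n) x²≡4b)))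
    where diff : ∀ s b → (+ 2 * s + + 1) * (+ 2 * s + + 1) - + 4 * b ≡ + 2 * (+ 2 * s * s + + 2 * s - + 2 * b) + + 1
          diff = solve-∀
  ... | even z = map (λ z≡y  → subst (2^ᶻ (2 ℕ.+ n) ∣_) (diff z y) (2^ᶻ-∣-*2 (1 ℕ.+ n) z≡y))
                     (λ z≡-y → subst (2^ᶻ (2 ℕ.+ n) ∣_) (sum z y) (2^ᶻ-∣-*2 (1 ℕ.+ n) z≡-y))
                     (sq≡sq⇒≡± n y z y-odd z²≡y²)
    where
    quarter : ∀ z b → + 2 * z * (+ 2 * z) - + 4 * b ≡ + 2 * (+ 2 * (z * z - b))
    quarter = solve-∀
    z²≡b : 2^ᶻ (2 ℕ.+ n) ∣ z * z - b
    z²≡b = 2^ᶻ-∣-/2 (2 ℕ.+ n) (2^ᶻ-∣-/2 (3 ℕ.+ n) (subst (2^ᶻ (4 ℕ.+ n) ∣_) (quarter z b) x²≡4b))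
    cancel : ∀ z y b → (z * z - b) - (y * y - b) ≡ z * z - y * y
    cancel = solve-∀
    z²≡y² : 2^ᶻ (2 ℕ.+ n) ∣ z * z - y * y
    z²≡y² = subst (2^ᶻ (2 ℕ.+ n) ∣_) (cancel z y b) (∣m∣n⇒∣m-n z²≡b y²≡b)
    diff : ∀ z y → + 2 * (z - y) ≡ + 2 * z - + 2 * y
    diff = solve-∀
    sum : ∀ z y → + 2 * (z + y) ≡ + 2 * z + + 2 * y
    sum = solve-∀

  ≡2y⇒≢-2y : ∀ n y x → ¬ (+ 2 ∣ y) → 2^ᶻ (3 ℕ.+ n) ∣ x - + 2 * y → ¬ (2^ᶻ (3 ℕ.+ n) ∣ x + + 2 * y)
  ≡2y⇒≢-2y n y x y-odd x≡2y x≡-2y =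
    y-odd (2^ᶻ-∣-weaken 1 n (2^ᶻ-∣-/2 (1 ℕ.+ n) (2^ᶻ-∣-/2 (2 ℕ.+ n) (subst (2^ᶻ (3 ℕ.+ n) ∣_) (diff x y) (∣m∣n⇒∣m-n x≡-2y x≡2y)))))
    where diff : ∀ x y → (x + + 2 * y) - (x - + 2 * y) ≡ + 2 * (+ 2 * y)
          diff = solve-∀

  residue-periodic : ∀ e c → Periodic (2 ^ e) (λ x → congPow2 e (+ x) c)
  residue-periodic e c x = congPow2-cong e (+ (2 ^ e ℕ.+ x)) c (+ x) c (divides (+ 1) (begin
    (+ (2 ^ e ℕ.+ x) - c) - (+ x - c) ≡⟨ cong (λ y → (y - c) - (+ x - c)) (ℤ.pos-+ (2 ^ e) x) ⟩
    (2^ᶻ e + + x - c) - (+ x - c)     ≡⟨ cancel (2^ᶻ e) (+ x) c ⟩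
    + 1 * 2^ᶻ e                       ∎))
    where cancel : ∀ Q x c → (Q + x - c) - (x - c) ≡ + 1 * Q
          cancel = solve-∀

  countUpTo-residue : ∀ e c → countUpTo (λ x → congPow2 e (+ x) c) (2 ^ e) ≡ 1
  countUpTo-residue e c = begin
    countUpTo (λ x → congPow2 e (+ x) c) Q         ≡⟨ countUpTo-shift Q (residue-periodic e c) s ⟨
    countUpTo (λ x → congPow2 e (+ (s ℕ.+ x)) c) Q ≡⟨ countUpTo-cong Q (λ j _ → shift-to-0 (suc j)) ⟩
    countUpTo multiple Q                           ≡⟨ cong (countUpTo multiple) (ℕ.suc-pred Q) ⟨
    countUpTo multiple (ℕ.pred Q) ℕ.+ indicator (multiple (suc (ℕ.pred Q)))
      ≡⟨ cong₂ ℕ._+_ (countUpTo-false (ℕ.pred Q) below-Q) (cong indicator at-Q) ⟩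
    1                                              ∎
    where
    Q = 2 ^ e
    instance Q≢0 : NonZero Q
    Q≢0 = ℕ.m^n≢0 2 e
    s = c %ℕ Q
    multiple : ℕ → Bool
    multiple x = congPow2 e (+ x) (+ 0)
    shift-to-0 : ∀ x → congPow2 e (+ (s ℕ.+ x)) c ≡ multiple x
    shift-to-0 x = congPow2-cong e (+ (s ℕ.+ x)) c (+ x) (+ 0) (divides (- (c /ℕ Q)) (begin
      (+ (s ℕ.+ x) - c) - (+ x - + 0)              ≡⟨ cong₂ (λ y c → (y - c) - (+ x - + 0)) (ℤ.pos-+ s x) (a≡a%ℕn+[a/ℕn]*n c Q) ⟩
      ((+ s + + x) - (+ s + c /ℕ Q * + Q)) - (+ x - + 0) ≡⟨ cancel (+ s) (+ x) (c /ℕ Q) (+ Q) ⟩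
      - (c /ℕ Q) * + Q                             ∎))
      where cancel : ∀ s x q Q → ((s + x) - (s + q * Q)) - (x - + 0) ≡ - q * Q
            cancel = solve-∀
    at-Q : multiple (suc (ℕ.pred Q)) ≡ true
    at-Q = ∣⇒congPow2 e (+ suc (ℕ.pred Q)) (+ 0) (divides (+ 1) (trans (ℤ.+-identityʳ _) (trans (cong +_ (ℕ.suc-pred Q)) (sym (ℤ.*-identityˡ (+ Q))))))
    below-Q : ∀ j → j ℕ.< ℕ.pred Q → multiple (suc j) ≡ false
    below-Q j j<Q-1 = ∤⇒congPow2 e (+ suc j) (+ 0) λ Q∣1+j →
      ℕ.<⇒≱ (ℕ.≤-<-trans j<Q-1 (ℕ.n<1+n _)) (subst (ℕ._≤ suc j) (sym (ℕ.suc-pred Q))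
        (ℕ.∣⇒≤ (subst (Q ℕ.∣_) (ℕ.+-identityʳ (suc j)) (∣⇒∣ᵤ Q∣1+j))))

  sqrtCount : ℕ → ℤ → ℕ
  sqrtCount e a = countUpTo (λ x → congPow2 e (+ x * + x) a) (2 ^ e)

  -- The square roots of 4b modulo 2^(5+n) are the x ≡ ±2y (mod 2^(3+n)), two disjoint classes.
  sqrtCount-4b≡8 : ∀ {b} → 2^ᶻ 3 ∣ b - + 1 → ∀ n → sqrtCount (5 ℕ.+ n) (+ 4 * b) ≡ 8
  sqrtCount-4b≡8 {b} b≡1 n = begin
    sqrtCount (5 ℕ.+ n) (+ 4 * b)                      ≡⟨ countUpTo-cong (2 ^ (5 ℕ.+ n)) (λ j _ → classes (suc j)) ⟩
    countUpTo (λ x → root₊ x ∨ root₋ x) (2 ^ (5 ℕ.+ n)) ≡⟨ countUpTo-∨ (2 ^ (5 ℕ.+ n)) disjoint ⟩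
    countUpTo root₊ (2 ^ (5 ℕ.+ n)) ℕ.+ countUpTo root₋ (2 ^ (5 ℕ.+ n))
      ≡⟨ cong₂ ℕ._+_ (four-roots (+ 2 * y)) (four-roots (- (+ 2 * y))) ⟩
    8                                                   ∎
    where
    t = proj₁ (∃-odd-sqrt b≡1 n)
    y = + 2 * t + + 1
    y²≡b : 2^ᶻ (3 ℕ.+ n) ∣ y * y - b
    y²≡b = proj₂ (∃-odd-sqrt b≡1 n)
    -y²≡b : 2^ᶻ (3 ℕ.+ n) ∣ (- y) * (- y) - b
    -y²≡b = subst (2^ᶻ (3 ℕ.+ n) ∣_) (neg-square y b) y²≡b
      where neg-square : ∀ y b → y * y - b ≡ (- y) * (- y) - b
            neg-square = solve-∀
    y-odd : ¬ (+ 2 ∣ y)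
    y-odd = odd-∤ t
    root₊ root₋ : ℕ → Bool
    root₊ x = congPow2 (3 ℕ.+ n) (+ x) (+ 2 * y)
    root₋ x = congPow2 (3 ℕ.+ n) (+ x) (- (+ 2 * y))
    negate : ∀ x y → x - - (+ 2 * y) ≡ x + + 2 * y
    negate = solve-∀
    negate′ : ∀ x y → x - - (+ 2 * y) ≡ x - + 2 * (- y)
    negate′ = solve-∀
    disjoint : ∀ x → root₊ x ≡ true → root₋ x ≡ true → ⊥
    disjoint x r₊ r₋ = ≡2y⇒≢-2y n y (+ x) y-odd (congPow2⇒∣ (3 ℕ.+ n) (+ x) (+ 2 * y) r₊)
      (subst (2^ᶻ (3 ℕ.+ n) ∣_) (negate (+ x) y) (congPow2⇒∣ (3 ℕ.+ n) (+ x) (- (+ 2 * y)) r₋))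
    classes : ∀ x → congPow2 (5 ℕ.+ n) (+ x * + x) (+ 4 * b) ≡ (root₊ x ∨ root₋ x)
    classes x with root₊ x in e₊ | root₋ x in e₋
    ... | true  | true  = ⊥-elim (disjoint x e₊ e₋)
    ... | true  | false = ∣⇒congPow2 (5 ℕ.+ n) (+ x * + x) (+ 4 * b)
                            (≡2y⇒sq≡4b (1 ℕ.+ n) b y (+ x) y²≡b (congPow2⇒∣ (3 ℕ.+ n) (+ x) (+ 2 * y) e₊))
    ... | false | true  = ∣⇒congPow2 (5 ℕ.+ n) (+ x * + x) (+ 4 * b) (≡2y⇒sq≡4b (1 ℕ.+ n) b (- y) (+ x) -y²≡b
                            (subst (2^ᶻ (3 ℕ.+ n) ∣_) (negate′ (+ x) y) (congPow2⇒∣ (3 ℕ.+ n) (+ x) (- (+ 2 * y)) e₋)))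
    ... | false | false = ∤⇒congPow2 (5 ℕ.+ n) (+ x * + x) (+ 4 * b) λ x²≡4b →
      [ (λ x≡2y  → false≢true (trans (sym e₊) (∣⇒congPow2 (3 ℕ.+ n) (+ x) (+ 2 * y) x≡2y)))
      , (λ x≡-2y → false≢true (trans (sym e₋) (∣⇒congPow2 (3 ℕ.+ n) (+ x) (- (+ 2 * y))
                     (subst (2^ᶻ (3 ℕ.+ n) ∣_) (sym (negate (+ x) y)) x≡-2y))))
      ] (sq≡4b⇒≡±2y (1 ℕ.+ n) b y (+ x) y-odd y²≡b x²≡4b)
      where false≢true : false ≡ true → ⊥
            false≢true ()
    four-roots : ∀ c → countUpTo (λ x → congPow2 (3 ℕ.+ n) (+ x) c) (2 ^ (5 ℕ.+ n)) ≡ 4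
    four-roots c = begin
      countUpTo (λ x → congPow2 (3 ℕ.+ n) (+ x) c) (2 ℕ.* (2 ℕ.* 2 ^ (3 ℕ.+ n))) ≡⟨ cong (countUpTo _) (ℕ.*-assoc 2 2 (2 ^ (3 ℕ.+ n))) ⟨
      countUpTo (λ x → congPow2 (3 ℕ.+ n) (+ x) c) (4 ℕ.* 2 ^ (3 ℕ.+ n))     ≡⟨ countUpTo-* (2 ^ (3 ℕ.+ n)) (residue-periodic (3 ℕ.+ n) c) 4 ⟩
      4 ℕ.* countUpTo (λ x → congPow2 (3 ℕ.+ n) (+ x) c) (2 ^ (3 ℕ.+ n))     ≡⟨ cong (4 ℕ.*_) (countUpTo-residue (3 ℕ.+ n) c) ⟩
      4                                                                         ∎

  sq≡4b[32]⇒b≡1[8] : ∀ x b → b ℕ.% 2 ≡ 1 → congPow2 5 (+ x * + x) (+ 4 * + b) ≡ true → b ℕ.% 8 ≡ 1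
  sq≡4b[32]⇒b≡1[8] x b b-odd x²≡4b =
    table (ℕ.m%n<n x 32) (ℕ.m%n<n b 8) (trans (ℕ.m∣n⇒o%n%m≡o%m 2 8 b (ℕ.divides 4 refl)) b-odd) (trans reduce x²≡4b)
    where
    x′ = x ℕ.% 32
    b′ = b ℕ.% 8
    table : ∀ {x′} → x′ ℕ.< 32 → ∀ {b′} → b′ ℕ.< 8 →
            b′ ℕ.% 2 ≡ 1 → congPow2 5 (+ x′ * + x′) (+ 4 * + b′) ≡ true → b′ ≡ 1
    table = toWitness {a? = ℕ.allUpTo? (λ x′ → ℕ.allUpTo? (λ b′ →
              (b′ ℕ.% 2 ℕ.≟ 1) →-dec ((congPow2 5 (+ x′ * + x′) (+ 4 * + b′) Bool.≟ true) →-dec (b′ ℕ.≟ 1))) 8) 32} _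
    x′≡x : 2^ᶻ 5 ∣ + x′ - + x
    x′≡x = %≡%⇒∣- x′ x (ℕ.m%n%n≡m%n x 32)
    b′≡b : + 8 ∣ + b′ - + b
    b′≡b = %≡%⇒∣- b′ b (ℕ.m%n%n≡m%n b 8)
    split : ∀ x′ x b′ b → - ((x′ - x) * (x′ + x) - + 4 * (b′ - b)) ≡ (x * x - + 4 * b) - (x′ * x′ - + 4 * b′)
    split = solve-∀
    reduce : congPow2 5 (+ x′ * + x′) (+ 4 * + b′) ≡ congPow2 5 (+ x * + x) (+ 4 * + b)
    reduce = sym (congPow2-cong 5 (+ x * + x) (+ 4 * + b) (+ x′ * + x′) (+ 4 * + b′)
      (subst (2^ᶻ 5 ∣_) (split (+ x′) (+ x) (+ b′) (+ b))
        (∣m⇒∣-m (∣m∣n⇒∣m-n (∣m⇒∣m*n (+ x′ + + x) x′≡x) (*-monoʳ-∣ (+ 4) b′≡b)))))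

  sqrtCount-4b≡0 : ∀ b → b ℕ.% 2 ≡ 1 → b ℕ.% 8 ≢ 1 → ∀ n → sqrtCount (5 ℕ.+ n) (+ 4 * + b) ≡ 0
  sqrtCount-4b≡0 b b-odd b≢1 n = countUpTo-false (2 ^ (5 ℕ.+ n)) λ j _ →
    ∤⇒congPow2 (5 ℕ.+ n) (+ suc j * + suc j) (+ 4 * + b) λ x²≡4b →
      b≢1 (sq≡4b[32]⇒b≡1[8] (suc j) b b-odd (∣⇒congPow2 5 (+ suc j * + suc j) (+ 4 * + b) (2^ᶻ-∣-weaken 5 n x²≡4b)))

module Solutions where

  open import Defs
  open Counting
  open Congruences
  open SquareRoots
  open import Data.Bool using (Bool; true; false; _∧_)
  open import Data.Bool.Properties using (∧-identityʳ; ∧-zeroʳ)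
  open import Data.Nat using (ℕ; suc; _+_; _*_; _^_; _%_; _/_; _≟_)
  open import Data.Nat.Properties using (*-identityʳ; +-comm; +-suc; *-assoc; *-distribʳ-+; *-distribˡ-+; ^-distribˡ-+-*)
  open import Data.Nat.DivMod using (%-distribˡ-+; %-distribˡ-*; %-remove-+ˡ; %-remove-+ʳ; m∣n⇒o%n%m≡o%m; m≡m%n+[m/n]*n)
  open import Data.Nat.Divisibility using (_∣_; divides; m∣m*n; ∣n⇒∣m*n; ∣m⇒∣m*n; m%n≡0⇒n∣m; n∣m⇒m%n≡0)
  import Data.Nat.Tactic.RingSolver as ℕ-Solver
  open import Data.Integer as ℤ using (ℤ; +_)
  import Data.Integer.Properties as ℤ
  import Data.Integer.Divisibility.Signed as ℤ
  import Data.Integer.Tactic.RingSolver as ℤ-Solver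
  open import Data.Sum using ([_,_]′)
  open import Relation.Nullary using (does)
  open import Relation.Binary.PropositionalEquality
    using (_≡_; _≢_; refl; sym; trans; cong; cong₂; subst; module ≡-Reasoning)
  open ≡-Reasoning

  parity-cong : ∀ {m m′ k k′} x → m % 2 ≡ m′ % 2 → k % 2 ≡ k′ % 2 →
                ((m * k + x) * m) % 2 ≡ ((m′ * k′ + x) * m′) % 2
  parity-cong {m} {m′} {k} {k′} x hm hk = trans (through-residues m k) (trans (cong₂ f hm hk) (sym (through-residues m′ k′)))
    where
    f : ℕ → ℕ → ℕ
    f a b = (((a * b) % 2 + x % 2) % 2 * a) % 2
    through-residues : ∀ m k → ((m * k + x) * m) % 2 ≡ f (m % 2) (k % 2)
    through-residues m k = begin
      ((m * k + x) * m) % 2                           ≡⟨ %-distribˡ-* (m * k + x) m 2 ⟩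
      ((m * k + x) % 2 * (m % 2)) % 2                 ≡⟨ cong (λ y → (y * (m % 2)) % 2) (%-distribˡ-+ (m * k) x 2) ⟩
      (((m * k) % 2 + x % 2) % 2 * (m % 2)) % 2       ≡⟨ cong (λ y → ((y + x % 2) % 2 * (m % 2)) % 2) (%-distribˡ-* m k 2) ⟩
      f (m % 2) (k % 2)                               ∎

  Jrhs : (k v r : ℕ) → ℤ
  Jrhs k v r = + (4 * k) ℤ.+ + (4 ^ v * r)

  -- The condition defining J_r(v): Jcard m k v r unfolds to countUpTo (Jcond m k v r) (2 ^ (2 * v + 3)).
  Jcond : (m k v r : ℕ) → ℕ → Bool
  Jcond m k v r j = congPow2 (2 * v + 3) ((+ j ℤ.- + (m * k)) ℤ.* (+ j ℤ.- + (m * k))) (Jrhs k v r)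
                  ∧ does ((j * m) % 2 ≟ 0)

  2∣2^[2v+1] : ∀ v → 2 ∣ 2 ^ (2 * v + 1)
  2∣2^[2v+1] v = subst (λ e → 2 ∣ 2 ^ e) (+-comm 1 (2 * v)) (m∣m*n (2 ^ (2 * v)))

  2^[2v+3]≡4*2^[2v+1] : ∀ v → 2 ^ (2 * v + 3) ≡ 4 * 2 ^ (2 * v + 1)
  2^[2v+3]≡4*2^[2v+1] v = trans (cong (2 ^_) (shift v)) (^-distribˡ-+-* 2 2 (2 * v + 1))
    where shift : ∀ v → 2 * v + 3 ≡ 2 + (2 * v + 1)
          shift = ℕ-Solver.solve-∀

  Jcond-periodic : ∀ m k v r → Periodic (2 ^ (2 * v + 3)) (Jcond m k v r)
  Jcond-periodic m k v r x = cong₂ _∧_ square-periodic parity-periodic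
    where
    Q = 2 ^ (2 * v + 3)
    c = + (m * k)
    R = Jrhs k v r
    A = (+ (Q + x) ℤ.- c) ℤ.* (+ (Q + x) ℤ.- c)
    A′ = (+ x ℤ.- c) ℤ.* (+ x ℤ.- c)
    expand : ∀ Q x c R → (((Q ℤ.+ x) ℤ.- c) ℤ.* ((Q ℤ.+ x) ℤ.- c) ℤ.- R) ℤ.- ((x ℤ.- c) ℤ.* (x ℤ.- c) ℤ.- R)
                       ≡ (+ 2 ℤ.* (x ℤ.- c) ℤ.+ Q) ℤ.* Q
    expand = ℤ-Solver.solve-∀
    square-periodic : congPow2 (2 * v + 3) A R ≡ congPow2 (2 * v + 3) A′ R
    square-periodic = congPow2-cong (2 * v + 3) A R A′ R (ℤ.divides (+ 2 ℤ.* (+ x ℤ.- c) ℤ.+ + Q) (begin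
      (A ℤ.- R) ℤ.- (A′ ℤ.- R)
        ≡⟨ cong (λ y → ((y ℤ.- c) ℤ.* (y ℤ.- c) ℤ.- R) ℤ.- (A′ ℤ.- R)) (ℤ.pos-+ Q x) ⟩
      (((+ Q ℤ.+ + x) ℤ.- c) ℤ.* ((+ Q ℤ.+ + x) ℤ.- c) ℤ.- R) ℤ.- (A′ ℤ.- R)
        ≡⟨ expand (+ Q) (+ x) c R ⟩
      (+ 2 ℤ.* (+ x ℤ.- c) ℤ.+ + Q) ℤ.* + Q ∎))
    2∣Q : 2 ∣ Q
    2∣Q = subst (2 ∣_) (sym (2^[2v+3]≡4*2^[2v+1] v)) (∣n⇒∣m*n 4 (2∣2^[2v+1] v))
    parity-periodic : does (((Q + x) * m) % 2 ≟ 0) ≡ does ((x * m) % 2 ≟ 0)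
    parity-periodic = cong (λ n → does (n ≟ 0))
      (trans (cong (_% 2) (*-distribʳ-+ m Q x)) (%-remove-+ˡ (x * m) (∣m⇒∣m*n m 2∣Q)))

  -- Jcond after the substitution j = m k + x.
  Jshifted : (m k v r : ℕ) → ℕ → Bool
  Jshifted m k v r x = congPow2 (2 * v + 3) (+ x ℤ.* + x) (Jrhs k v r) ∧ does (((m * k + x) * m) % 2 ≟ 0)

  Jcard-shift : ∀ m k v r → Jcard m k v r ≡ countUpTo (Jshifted m k v r) (2 ^ (2 * v + 3))
  Jcard-shift m k v r = begin
    countUpTo (Jcond m k v r) Q                   ≡⟨ countUpTo-shift Q (Jcond-periodic m k v r) (m * k) ⟨
    countUpTo (λ x → Jcond m k v r (m * k + x)) Q ≡⟨ countUpTo-cong Q (λ j _ → substitute (suc j)) ⟩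
    countUpTo (Jshifted m k v r) Q                ∎
    where
    Q = 2 ^ (2 * v + 3)
    c+x-c : ∀ c x → c ℤ.+ x ℤ.- c ≡ x
    c+x-c = ℤ-Solver.solve-∀
    substitute : ∀ x → Jcond m k v r (m * k + x) ≡ Jshifted m k v r x
    substitute x = cong (λ y → congPow2 (2 * v + 3) (y ℤ.* y) (Jrhs k v r) ∧ does (((m * k + x) * m) % 2 ≟ 0))
      (trans (cong (ℤ._- + (m * k)) (ℤ.pos-+ (m * k) x)) (c+x-c (+ (m * k)) (+ x)))

  ≡[2^[2v+1]]⇒≡[2] : ∀ {k k′} v → 2^ᶻ (2 * v + 1) ℤ.∣ + k ℤ.- + k′ → k % 2 ≡ k′ % 2
  ≡[2^[2v+1]]⇒≡[2] {k} {k′} v k≡k′ =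
    ∣-⇒%≡% k k′ (2^ᶻ-∣-weaken 1 (2 * v) (subst (λ e → 2^ᶻ e ℤ.∣ + k ℤ.- + k′) (+-comm (2 * v) 1) k≡k′))

  Jcard-cong : ∀ {m m′ k k′} v r → m % 2 ≡ m′ % 2 → 2^ᶻ (2 * v + 1) ℤ.∣ + k ℤ.- + k′ →
               Jcard m k v r ≡ Jcard m′ k′ v r
  Jcard-cong {m} {m′} {k} {k′} v r hm k≡k′ = begin
    Jcard m k v r                     ≡⟨ Jcard-shift m k v r ⟩
    countUpTo (Jshifted m k v r) Q    ≡⟨ countUpTo-cong Q (λ j _ → pointwise (suc j)) ⟩
    countUpTo (Jshifted m′ k′ v r) Q  ≡⟨ Jcard-shift m′ k′ v r ⟨
    Jcard m′ k′ v r                   ∎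
    where
    Q = 2 ^ (2 * v + 3)
    4k≡4k′ : + Q ℤ.∣ + 4 ℤ.* (+ k′ ℤ.- + k)
    4k≡4k′ = subst (ℤ._∣ + 4 ℤ.* (+ k′ ℤ.- + k)) (trans (sym (ℤ.pos-* 4 (2 ^ (2 * v + 1)))) (cong +_ (sym (2^[2v+3]≡4*2^[2v+1] v))))
               (ℤ.*-monoʳ-∣ (+ 4) (subst (2^ᶻ (2 * v + 1) ℤ.∣_) (flip (+ k) (+ k′)) (ℤ.∣m⇒∣-m k≡k′)))
      where flip : ∀ a b → ℤ.- (a ℤ.- b) ≡ b ℤ.- a
            flip = ℤ-Solver.solve-∀
    rhs≡ : ∀ X → congPow2 (2 * v + 3) X (Jrhs k v r) ≡ congPow2 (2 * v + 3) X (Jrhs k′ v r)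
    rhs≡ X = congPow2-cong (2 * v + 3) X (Jrhs k v r) X (Jrhs k′ v r) (subst (+ Q ℤ.∣_) (sym (begin
      (X ℤ.- Jrhs k v r) ℤ.- (X ℤ.- Jrhs k′ v r)
        ≡⟨ cong₂ (λ a a′ → (X ℤ.- (a ℤ.+ R)) ℤ.- (X ℤ.- (a′ ℤ.+ R))) (ℤ.pos-* 4 k) (ℤ.pos-* 4 k′) ⟩
      (X ℤ.- (+ 4 ℤ.* + k ℤ.+ R)) ℤ.- (X ℤ.- (+ 4 ℤ.* + k′ ℤ.+ R))
        ≡⟨ cancel X (+ k) (+ k′) R ⟩
      + 4 ℤ.* (+ k′ ℤ.- + k) ∎)) 4k≡4k′)
      where
      R = + (4 ^ v * r)
      cancel : ∀ X k k′ R → (X ℤ.- (+ 4 ℤ.* k ℤ.+ R)) ℤ.- (X ℤ.- (+ 4 ℤ.* k′ ℤ.+ R)) ≡ + 4 ℤ.* (k′ ℤ.- k)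
      cancel = ℤ-Solver.solve-∀
    pointwise : ∀ x → Jshifted m k v r x ≡ Jshifted m′ k′ v r x
    pointwise x = cong₂ _∧_ (rhs≡ (+ x ℤ.* + x))
      (cong (λ n → does (n ≟ 0)) (parity-cong {m} {m′} {k} {k′} x hm (≡[2^[2v+1]]⇒≡[2] {k} {k′} v k≡k′)))

  Jcard≡sqrtCount : ∀ {m} k v r → m % 2 ≡ 0 → Jcard m k v r ≡ sqrtCount (2 * v + 3) (Jrhs k v r)
  Jcard≡sqrtCount {m} k v r hm = trans (Jcard-shift m k v r) (countUpTo-cong (2 ^ (2 * v + 3)) λ j _ →
    trans (cong (congPow2 (2 * v + 3) (+ suc j ℤ.* + suc j) (Jrhs k v r) ∧_) (m-even (m * k + suc j))) (∧-identityʳ _))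
    where
    m-even : ∀ y → does ((y * m) % 2 ≟ 0) ≡ true
    m-even y = cong (λ n → does (n ≟ 0)) (n∣m⇒m%n≡0 (y * m) 2 (∣n⇒∣m*n y (m%n≡0⇒n∣m m 2 hm)))

  Jrhs-suc : ∀ k v r → Jrhs k (suc v) r ≡ + 4 ℤ.* + (k + 4 ^ v * r)
  Jrhs-suc k v r = begin
    + (4 * k) ℤ.+ + (4 * 4 ^ v * r)       ≡⟨ cong (λ y → + (4 * k) ℤ.+ + y) (*-assoc 4 (4 ^ v) r) ⟩
    + (4 * k) ℤ.+ + (4 * (4 ^ v * r))     ≡⟨ ℤ.pos-+ (4 * k) (4 * (4 ^ v * r)) ⟨
    + (4 * k + 4 * (4 ^ v * r))           ≡⟨ cong +_ (*-distribˡ-+ 4 k (4 ^ v * r)) ⟨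
    + (4 * (k + 4 ^ v * r))               ≡⟨ ℤ.pos-* 4 (k + 4 ^ v * r) ⟩
    + 4 ℤ.* + (k + 4 ^ v * r)             ∎

  Jcard-odd-odd : ∀ {m k} v r → m % 2 ≡ 1 → k % 2 ≡ 1 → Jcard m k (suc v) r ≡ 0
  Jcard-odd-odd {m} {k} v r hm hk =
    trans (Jcard-shift m k (suc v) r) (countUpTo-false (2 ^ e) λ j _ → [ x-even (suc j) , x-odd (suc j) ]′ (%2≡0⊎%2≡1 (suc j)))
    where
    e = 2 * suc v + 3
    x-even : ∀ x → x % 2 ≡ 0 → Jshifted m k (suc v) r x ≡ false
    x-even x hx = trans (cong (λ n → congPow2 e (+ x ℤ.* + x) (Jrhs k (suc v) r) ∧ does (n ≟ 0)) (begin
      ((m * k + x) * m) % 2   ≡⟨ parity-cong {m} {1} {k} {1} x hm hk ⟩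
      ((1 + x) * 1) % 2       ≡⟨ cong (_% 2) (*-identityʳ (1 + x)) ⟩
      (1 + x) % 2             ≡⟨ %-distribˡ-+ 1 x 2 ⟩
      (1 + x % 2) % 2         ≡⟨ cong (λ y → (1 + y) % 2) hx ⟩
      1                       ∎)) (∧-zeroʳ _)
    x-odd : ∀ x → x % 2 ≡ 1 → Jshifted m k (suc v) r x ≡ false
    x-odd x hx = cong (_∧ does (((m * k + x) * m) % 2 ≟ 0)) (∤⇒congPow2 e (+ x ℤ.* + x) (Jrhs k (suc v) r) λ p →
      odd-∤ (+ 2 ℤ.* s ℤ.* s ℤ.+ + 2 ℤ.* s ℤ.- + 2 ℤ.* B) (subst (+ 2 ℤ.∣_) (odd-difference x≡2s+1 (Jrhs-suc k v r))
        (2^ᶻ-∣-weaken 1 (2 * suc v + 2) (subst (λ e → 2^ᶻ e ℤ.∣ + x ℤ.* + x ℤ.- Jrhs k (suc v) r) (+-suc (2 * suc v) 2) p))))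
      where
      s = + (x / 2)
      B = + (k + 4 ^ v * r)
      x≡2s+1 : + x ≡ + 2 ℤ.* s ℤ.+ + 1
      x≡2s+1 = begin
        + x                          ≡⟨ cong +_ (trans (m≡m%n+[m/n]*n x 2) (cong (_+ x / 2 * 2) hx)) ⟩
        + (1 + x / 2 * 2)            ≡⟨ ℤ.pos-+ 1 (x / 2 * 2) ⟩
        + 1 ℤ.+ + (x / 2 * 2)        ≡⟨ cong (ℤ._+_ (+ 1)) (ℤ.pos-* (x / 2) 2) ⟩
        + 1 ℤ.+ s ℤ.* + 2            ≡⟨ swap s ⟩
        + 2 ℤ.* s ℤ.+ + 1            ∎
        where swap : ∀ s → + 1 ℤ.+ s ℤ.* + 2 ≡ + 2 ℤ.* s ℤ.+ + 1
              swap = ℤ-Solver.solve-∀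
      odd-difference : ∀ {X R} → X ≡ + 2 ℤ.* s ℤ.+ + 1 → R ≡ + 4 ℤ.* B →
                       X ℤ.* X ℤ.- R ≡ + 2 ℤ.* (+ 2 ℤ.* s ℤ.* s ℤ.+ + 2 ℤ.* s ℤ.- + 2 ℤ.* B) ℤ.+ + 1
      odd-difference refl refl = expand s B
        where expand : ∀ s B → (+ 2 ℤ.* s ℤ.+ + 1) ℤ.* (+ 2 ℤ.* s ℤ.+ + 1) ℤ.- + 4 ℤ.* B
                             ≡ + 2 ℤ.* (+ 2 ℤ.* s ℤ.* s ℤ.+ + 2 ℤ.* s ℤ.- + 2 ℤ.* B) ℤ.+ + 1
              expand = ℤ-Solver.solve-∀

  Jcard-tail : ∀ {m} k w r → m % 2 ≡ 0 →
               Jcard m k (3 + w) r ≡ sqrtCount (5 + (4 + 2 * w)) (+ 4 ℤ.* + (k + 4 ^ (2 + w) * r))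
  Jcard-tail k w r hm = trans (Jcard≡sqrtCount k (3 + w) r hm) (cong₂ sqrtCount (exponent w) (Jrhs-suc k (2 + w) r))
    where exponent : ∀ w → 2 * (3 + w) + 3 ≡ 5 + (4 + 2 * w)
          exponent = ℕ-Solver.solve-∀

  tail-residue : ∀ k w r → (k + 4 ^ (2 + w) * r) % 8 ≡ k % 8
  tail-residue k w r = %-remove-+ʳ k (∣m⇒∣m*n r (divides (2 * 4 ^ w) (sixteen (4 ^ w))))
    where sixteen : ∀ y → 4 * (4 * y) ≡ 2 * y * 8
          sixteen = ℕ-Solver.solve-∀

  Jcard-tail-≡1 : ∀ {m k} w r → m % 2 ≡ 0 → k % 8 ≡ 1 → Jcard m k (3 + w) r ≡ 8
  Jcard-tail-≡1 {k = k} w r hm hk = trans (Jcard-tail k w r hm)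
    (sqrtCount-4b≡8 {+ (k + 4 ^ (2 + w) * r)} (%≡%⇒∣- (k + 4 ^ (2 + w) * r) 1 (trans (tail-residue k w r) hk)) (4 + 2 * w))

  Jcard-tail-≢1 : ∀ {m k} w r → m % 2 ≡ 0 → k % 2 ≡ 1 → k % 8 ≢ 1 → Jcard m k (3 + w) r ≡ 0
  Jcard-tail-≢1 {k = k} w r hm k-odd k≢1 = trans (Jcard-tail k w r hm)
    (sqrtCount-4b≡0 b b-odd (λ b≡1 → k≢1 (trans (sym b≡k) b≡1)) (4 + 2 * w))
    where
    b = k + 4 ^ (2 + w) * r
    b≡k : b % 8 ≡ k % 8
    b≡k = tail-residue k w r
    b-odd : b % 2 ≡ 1
    b-odd = begin
      b % 2       ≡⟨ m∣n⇒o%n%m≡o%m 2 8 b (divides 4 refl) ⟨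
      b % 8 % 2   ≡⟨ cong (_% 2) b≡k ⟩
      k % 8 % 2   ≡⟨ m∣n⇒o%n%m≡o%m 2 8 k (divides 4 refl) ⟩
      k % 2       ≡⟨ k-odd ⟩
      1           ∎

module Series where

  open import Defs
  open import Data.Nat as ℕ using (ℕ; zero; suc; _^_; NonZero; s≤s; z≤n)
  import Data.Nat.Properties as ℕ
  open import Data.Nat.GCD using (gcd-zeroˡ)
  open import Data.Integer as ℤ using (ℤ; 0ℤ; +_; +[1+_]; -[1+_])
  import Data.Integer.GCD as ℤ
  import Data.Integer.Properties as ℤ
  open import Data.Rational using (ℚ; mkℚ; *≡*; *≤*; *<*; nonNegative; 0ℚ; 1ℚ; _/_; _+_; _*_; _-_; -_; ∣_∣; _≤_; _<_; ↥_; ↧_)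
  open import Data.Rational.Properties
    using (↥-/; ↧-/; ↥-*; ↧-*; ≃⇒≡; ≤-<-trans; +-inverseʳ; +-identityˡ; +-identityʳ; *-identityˡ;
           *-monoʳ-≤-nonNeg; nonNeg*nonNeg⇒nonNeg; 0≤p⇒∣p∣≡p; ∣-p∣≡∣p∣; nonNegative⁻¹; module ≤-Reasoning)
  open import Data.Product using (∃; _,_)
  open import Relation.Binary.PropositionalEquality
    using (_≡_; refl; sym; trans; cong; cong₂; subst; subst₂; module ≡-Reasoning)
  open import Data.Rational.Solver using (module +-*-Solver)
  open +-*-Solver using (solve; _:-_; _:*_; :-_; _:=_)

  private
    cancel-gcd : ∀ {x g y} → x ℤ.* g ≡ y → g ≡ + 1 → x ≡ y
    cancel-gcd {x} eq refl = trans (sym (ℤ.*-identityʳ x)) eq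

  ↥[1/n]≡1 : ∀ n .{{_ : NonZero n}} → ↥ (+ 1 / n) ≡ + 1
  ↥[1/n]≡1 n = cancel-gcd (↥-/ (+ 1) n) (cong +_ (gcd-zeroˡ n))

  ↧[1/n]≡n : ∀ n .{{_ : NonZero n}} → ↧ (+ 1 / n) ≡ + n
  ↧[1/n]≡n n = cancel-gcd (↧-/ (+ 1) n) (cong +_ (gcd-zeroˡ n))

  1/m*1/n≡1/[m*n] : ∀ m n .{{_ : NonZero m}} .{{_ : NonZero n}} →
                    (+ 1 / m) * (+ 1 / n) ≡ (+ 1 / (m ℕ.* n)) {{ℕ.m*n≢0 m n}}
  1/m*1/n≡1/[m*n] m n = ≃⇒≡ (*≡* (begin
    ↥ (p * q) ℤ.* ↧ r     ≡⟨ cong₂ ℤ._*_ ↥pq≡1 (↧[1/n]≡n (m ℕ.* n) {{ℕ.m*n≢0 m n}}) ⟩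
    + 1 ℤ.* + (m ℕ.* n)   ≡⟨ cong₂ ℤ._*_ (sym (↥[1/n]≡1 (m ℕ.* n) {{ℕ.m*n≢0 m n}})) (sym ↧pq≡mn) ⟩
    ↥ r ℤ.* ↧ (p * q)     ∎))
    where
    open ≡-Reasoning
    p = + 1 / m
    q = + 1 / n
    r = (+ 1 / (m ℕ.* n)) {{ℕ.m*n≢0 m n}}
    gcd≡1 : ℤ.gcd (↥ p ℤ.* ↥ q) (↧ p ℤ.* ↧ q) ≡ + 1
    gcd≡1 = trans (cong (λ x → ℤ.gcd x (↧ p ℤ.* ↧ q)) (cong₂ ℤ._*_ (↥[1/n]≡1 m) (↥[1/n]≡1 n))) (cong +_ (gcd-zeroˡ ℤ.∣ ↧ p ℤ.* ↧ q ∣))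
    ↥pq≡1 : ↥ (p * q) ≡ + 1
    ↥pq≡1 = trans (cancel-gcd (↥-* p q) gcd≡1) (cong₂ ℤ._*_ (↥[1/n]≡1 m) (↥[1/n]≡1 n))
    ↧pq≡mn : ↧ (p * q) ≡ + (m ℕ.* n)
    ↧pq≡mn = trans (cancel-gcd (↧-* p q) gcd≡1) (trans (cong₂ ℤ._*_ (↧[1/n]≡n m) (↧[1/n]≡n n)) (sym (ℤ.pos-* m n)))

  ⅛^_ : ℕ → ℚ
  ⅛^ n = (+ 1 / 8 ^ n) {{ℕ.m^n≢0 8 n}}

  ⅛^-suc : ∀ n → ⅛^ suc n ≡ (+ 1 / 8) * ⅛^ n
  ⅛^-suc n = sym (1/m*1/n≡1/[m*n] 8 (8 ^ n) {{_}} {{ℕ.m^n≢0 8 n}})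

  0≤⅛^ : ∀ n → 0ℚ ≤ ⅛^ n
  0≤⅛^ n = *≤* (subst (λ y → 0ℤ ℤ.≤ y ℤ.* + 1) (sym (↥[1/n]≡1 (8 ^ n) {{ℕ.m^n≢0 8 n}})) (ℤ.+≤+ z≤n))

  n<8^n : ∀ n → n ℕ.< 8 ^ n
  n<8^n zero    = s≤s z≤n
  n<8^n (suc n) = ℕ.≤-<-trans (n<8^n n)
    (subst (8 ^ n ℕ.<_) (ℕ.*-comm (8 ^ n) 8) (ℕ.m<m*n (8 ^ n) 8 {{ℕ.m^n≢0 8 n}} (s≤s (s≤s z≤n))))

  ⅛^-< : ∀ ε → 0ℚ < ε → ∃ λ N → ∀ n → N ℕ.≤ n → ⅛^ n < ε
  ⅛^-< (mkℚ +[1+ p ] d _) _   = suc d , λ n d<n → *<* (subst₂ ℤ._<_ (sym (lhs n)) (sym (rhs n))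
    (ℤ.+<+ (ℕ.<-≤-trans (ℕ.≤-<-trans d<n (n<8^n n)) (ℕ.m≤n*m (8 ^ n) (suc p)))))
    where
    lhs : ∀ n → ↥ (⅛^ n) ℤ.* + suc d ≡ + suc d
    lhs n = trans (cong (ℤ._* + suc d) (↥[1/n]≡1 (8 ^ n) {{ℕ.m^n≢0 8 n}})) (ℤ.*-identityˡ (+ suc d))
    rhs : ∀ n → +[1+ p ] ℤ.* ↧ (⅛^ n) ≡ + (suc p ℕ.* 8 ^ n)
    rhs n = trans (cong (+[1+ p ] ℤ.*_) (↧[1/n]≡n (8 ^ n) {{ℕ.m^n≢0 8 n}})) (sym (ℤ.pos-* (suc p) (8 ^ n)))
  ⅛^-< (mkℚ (+ 0) d _) (*<* (ℤ.+<+ ()))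
  ⅛^-< (mkℚ -[1+ p ] d _) (*<* ())

  SeriesSumsTo-≤⅛^ : ∀ {a s} K → (∀ n → ∣ partialSum a (K ℕ.+ n) - s ∣ ≤ ⅛^ n) → SeriesSumsTo a s
  SeriesSumsTo-≤⅛^ {a} {s} K error ε ε>0 with ⅛^-< ε ε>0
  ... | N , small = K ℕ.+ N , λ n K+N≤n →
    subst (λ i → ∣ partialSum a i - s ∣ < ε) (ℕ.m+[n∸m]≡n (ℕ.≤-trans (ℕ.m≤m+n K N) K+N≤n))
      (≤-<-trans (error (n ℕ.∸ K)) (small (n ℕ.∸ K) (subst (ℕ._≤ n ℕ.∸ K) (ℕ.m+n∸m≡n K N) (ℕ.∸-monoˡ-≤ K K+N≤n))))

  SeriesSumsTo-const : ∀ {a s} K → (∀ n → partialSum a (K ℕ.+ n) ≡ s) → SeriesSumsTo a s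
  SeriesSumsTo-const {a} {s} K const = SeriesSumsTo-≤⅛^ K λ n →
    subst (λ y → ∣ y - s ∣ ≤ ⅛^ n) (sym (const n)) (subst (λ y → ∣ y ∣ ≤ ⅛^ n) (sym (+-inverseʳ s)) (0≤⅛^ n))

  SeriesSumsTo-head : ∀ {a} → (∀ v → a (suc v) ≡ 0ℚ) → SeriesSumsTo a (a 0)
  SeriesSumsTo-head {a} later = SeriesSumsTo-const 1 partial
    where
    partial : ∀ n → partialSum a (1 ℕ.+ n) ≡ a 0
    partial zero    = +-identityˡ (a 0)
    partial (suc n) = trans (cong₂ _+_ (partial n) (later n)) (+-identityʳ (a 0))

  ∣[s-d*x]-s∣≤x : ∀ s d x → 0ℚ ≤ d → d ≤ 1ℚ → 0ℚ ≤ x → ∣ (s - d * x) - s ∣ ≤ x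
  ∣[s-d*x]-s∣≤x s d x 0≤d d≤1 0≤x = begin
    ∣ (s - d * x) - s ∣ ≡⟨ cong ∣_∣ (solve 3 (λ s d x → (s :- d :* x) :- s := :- (d :* x)) refl s d x) ⟩
    ∣ - (d * x) ∣       ≡⟨ ∣-p∣≡∣p∣ (d * x) ⟩
    ∣ d * x ∣           ≡⟨ 0≤p⇒∣p∣≡p (nonNegative⁻¹ (d * x) {{nonNeg*nonNeg⇒nonNeg d {{nonNegative 0≤d}} x {{nonNegative 0≤x}}}}) ⟩
    d * x               ≤⟨ *-monoʳ-≤-nonNeg x {{nonNegative 0≤x}} d≤1 ⟩
    1ℚ * x              ≡⟨ *-identityˡ x ⟩
    x                   ∎
    where open ≤-Reasoning

module Terms where

  open import Defs
  open Congruences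
  open Solutions
  open Series
  open import Data.Bool using (true; false; if_then_else_)
  open import Data.Nat as ℕ using (ℕ; zero; suc; _^_; _%_; _≟_; _<_; NonZero)
  open import Data.Nat.DivMod using (m%n%n≡m%n; m∣n⇒o%n%m≡o%m; m%n<n)
  open import Data.Nat.Divisibility using (_∣_; divides; m∣m*n; n∣m⇒m%n≡0; m%n≡0⇒n∣m)
  open import Data.Nat.Coprimality using (Coprime; coprime?; 1-coprimeTo)
  open import Data.Integer as ℤ using (ℤ; +_)
  import Data.Integer.Divisibility.Signed as ℤ
  open import Data.Rational as ℚ using (ℚ; 0ℚ; 1ℚ; _/_; _+_; _*_; _-_; _≤_; *≤*)
  open import Data.Rational.Properties using (*-zeroˡ; +-identityʳ; /-cong) renaming (_≟_ to _≟ℚ_)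
  open import Data.Rational.Solver using (module +-*-Solver)
  open +-*-Solver using (solve; con; _:+_; _:-_; _:*_; _:=_)
  open import Data.Product using (_,_)
  open import Data.Sum using ([_,_]′)
  open import Function using (_⇔_; mk⇔; _∘_; Equivalence)
  open import Relation.Nullary using (¬_; does; contradiction; _→-dec_; ¬?)
  open import Relation.Nullary.Decidable using (does-⇔; dec-true; dec-false; toWitness; toSum)
  open import Relation.Binary.PropositionalEquality
    using (_≡_; _≢_; refl; sym; trans; cong; cong₂; subst; module ≡-Reasoning)

  twoPowV0m1≢0 : ∀ m → NonZero (twoPowV0m1 m)
  twoPowV0m1≢0 m with does (m % 2 ≟ 0)
  ... | true  = _
  ... | false = _

  -- calJ m k v unfolds to weightedJ (Jcard m k v) * v₀-factor m.
  weightedJ : (ℕ → ℕ) → ℚ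
  weightedJ J = + J 0 / 2 + + J 1 / 1 + + J 4 / 2 + + J 5 / 3

  weightedJ-cong : ∀ {J J′} → (∀ r → J r ≡ J′ r) → weightedJ J ≡ weightedJ J′
  weightedJ-cong {J} {J′} eq = cong₂ _+_ (cong₂ _+_ (cong₂ _+_ (term 0 2) (term 1 1)) (term 4 2)) (term 5 3)
    where term : ∀ r d .{{_ : NonZero d}} → + J r / d ≡ + J′ r / d
          term r d = cong (λ j → + j / d) (eq r)

  v₀-factor : ℕ → ℚ
  v₀-factor m = (+ 1 / twoPowV0m1 m) {{twoPowV0m1≢0 m}}

  v₀-factor-cong : ∀ {m m′} → m % 2 ≡ m′ % 2 → v₀-factor m ≡ v₀-factor m′
  v₀-factor-cong {m} {m′} hm = /-cong {+ 1} {twoPowV0m1 m} {+ 1} {twoPowV0m1 m′} {{twoPowV0m1≢0 m}} {{twoPowV0m1≢0 m′}}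
    refl (cong (λ b → if does (b ≟ 0) then 4 else 2) hm)

  calJ-cong : ∀ m k v m′ k′ v′ → m % 2 ≡ m′ % 2 → (∀ r → Jcard m k v r ≡ Jcard m′ k′ v′ r) → calJ m k v ≡ calJ m′ k′ v′
  calJ-cong m k v m′ k′ v′ hm hJ = cong₂ _*_ (weightedJ-cong {Jcard m k v} {Jcard m′ k′ v′} hJ) (v₀-factor-cong {m} {m′} hm)

  calJ-vanishing : ∀ m k v → (∀ r → Jcard m k v r ≡ 0) → calJ m k v ≡ 0ℚ
  calJ-vanishing m k v hJ = trans (cong (_* v₀-factor m) (weightedJ-cong {Jcard m k v} hJ)) (*-zeroˡ (v₀-factor m))

  calJ-eight : ∀ m k v → m % 2 ≡ 0 → (∀ r → Jcard m k v r ≡ 8) → calJ m k v ≡ + 14 / 3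
  calJ-eight m k v hm hJ = cong₂ _*_ (weightedJ-cong {Jcard m k v} hJ) (v₀-factor-cong {m} {0} hm)

  coprime[2^[1+i],k]⇔2∤k : ∀ i k → Coprime (2 ^ suc i) k ⇔ (¬ 2 ∣ k)
  coprime[2^[1+i],k]⇔2∤k i k = mk⇔ (λ (coprime : Coprime (2 ^ suc i) k) 2∣k → contradiction (coprime {2} (m∣m*n (2 ^ i) , 2∣k)) λ ())
                                   (λ 2∤k → 2^-coprime 2∤k (suc i))

  coprime?-cong : ∀ {k k′} v → k % 2 ≡ k′ % 2 → does (coprime? (2 ^ v) k) ≡ does (coprime? (2 ^ v) k′)
  coprime?-cong {k} {k′} zero    _  = trans (dec-true (coprime? 1 k) (1-coprimeTo k)) (sym (dec-true (coprime? 1 k′) (1-coprimeTo k′)))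
  coprime?-cong {k} {k′} (suc i) hk = does-⇔ (mk⇔ (transfer k k′ hk) (transfer k′ k (sym hk))) (coprime? (2 ^ suc i) k) (coprime? (2 ^ suc i) k′)
    where
    transfer : ∀ k k′ → k % 2 ≡ k′ % 2 → Coprime (2 ^ suc i) k → Coprime (2 ^ suc i) k′
    transfer k k′ hk c = Equivalence.from (coprime[2^[1+i],k]⇔2∤k i k′)
      (λ 2∣k′ → Equivalence.to (coprime[2^[1+i],k]⇔2∤k i k) c (m%n≡0⇒n∣m k 2 (trans hk (n∣m⇒m%n≡0 k′ 2 2∣k′))))

  calJTerm-cong : ∀ m k m′ k′ v → m % 2 ≡ m′ % 2 → 2^ᶻ (2 ℕ.* v ℕ.+ 1) ℤ.∣ + k ℤ.- + k′ → calJTerm m k v ≡ calJTerm m′ k′ v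
  calJTerm-cong m k m′ k′ v hm hk = cong₂ (λ b x → if b then x * ⅛^ v else 0ℚ)
    (coprime?-cong {k} {k′} v (≡[2^[2v+1]]⇒≡[2] {k} {k′} v hk)) (calJ-cong m k v m′ k′ v hm (λ r → Jcard-cong {m} {m′} {k} {k′} v r hm hk))

  calJTerm-coprime : ∀ m k v → Coprime (2 ^ v) k → calJTerm m k v ≡ calJ m k v * ⅛^ v
  calJTerm-coprime m k v c = cong (λ b → if b then calJ m k v * ⅛^ v else 0ℚ) (dec-true (coprime? (2 ^ v) k) c)

  calJTerm-even : ∀ m k v → 2 ∣ k → calJTerm m k (suc v) ≡ 0ℚ
  calJTerm-even m k v 2∣k = cong (λ b → if b then calJ m k (suc v) * ⅛^ suc v else 0ℚ)
    (dec-false (coprime? (2 ^ suc v) k) λ c → Equivalence.to (coprime[2^[1+i],k]⇔2∤k v k) c 2∣k)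

  calJTerm-vanishing : ∀ m k v → calJ m k v ≡ 0ℚ → calJTerm m k v ≡ 0ℚ
  calJTerm-vanishing m k v h = vanish (does (coprime? (2 ^ v) k))
    where
    vanish : ∀ b → (if b then calJ m k v * ⅛^ v else 0ℚ) ≡ 0ℚ
    vanish true  = trans (cong (_* ⅛^ v) h) (*-zeroˡ (⅛^ v))
    vanish false = refl

  calJTerm₀-mod2 : ∀ m k → calJTerm m k 0 ≡ calJTerm (m % 2) (k % 2) 0
  calJTerm₀-mod2 m k = calJTerm-cong m k (m % 2) (k % 2) 0 (sym (m%n%n≡m%n m 2)) (%≡%⇒∣- k (k % 2) (sym (m%n%n≡m%n k 2)))

  SeriesSumsTo-calJTerm₀ : ∀ m k → (∀ v → calJTerm m k (suc v) ≡ 0ℚ) → SeriesSumsTo (calJTerm m k) (calJTerm (m % 2) (k % 2) 0)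
  SeriesSumsTo-calJTerm₀ m k later = subst (SeriesSumsTo (calJTerm m k)) (calJTerm₀-mod2 m k) (SeriesSumsTo-head later)

  partialSum₃-mod32 : ∀ m k → m % 2 ≡ 0 → k % 2 ≡ 1 → partialSum (calJTerm m k) 3 ≡ partialSum (calJTerm 0 (k % 32)) 3
  partialSum₃-mod32 m k hm hk = cong₂ _+_ (cong₂ _+_ (cong (_+_ 0ℚ) (term 0 16 refl)) (term 1 4 refl)) (term 2 1 refl)
    where
    k≡k%32 : + 32 ℤ.∣ + k ℤ.- + (k % 32)
    k≡k%32 = %≡%⇒∣- k (k % 32) (sym (m%n%n≡m%n k 32))
    term : ∀ v q → 32 ≡ q ℕ.* 2 ^ (2 ℕ.* v ℕ.+ 1) → calJTerm m k v ≡ calJTerm 0 (k % 32) v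
    term v q eq = calJTerm-cong m k 0 (k % 32) v hm (ℤ.∣-trans (ℤ.∣ᵤ⇒∣ (divides q eq)) k≡k%32)

  partialSum₃-table-≡1 : ∀ {t} → t < 32 → t % 8 ≡ 1 → partialSum (calJTerm 0 t) 3 ≡ + 95 / 96
  partialSum₃-table-≡1 = toWitness {a? = ℕ.allUpTo? (λ t → (t % 8 ≟ 1) →-dec (partialSum (calJTerm 0 t) 3 ≟ℚ + 95 / 96)) 32} _

  partialSum₃-table-≢1 : ∀ {t} → t < 32 → t % 2 ≡ 1 → t % 8 ≢ 1 → partialSum (calJTerm 0 t) 3 ≡ 1ℚ
  partialSum₃-table-≢1 = toWitness {a? = ℕ.allUpTo? (λ t → (t % 2 ≟ 1) →-dec (¬? (t % 8 ≟ 1) →-dec (partialSum (calJTerm 0 t) 3 ≟ℚ 1ℚ))) 32} _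

  𝒥-odd-odd : ∀ {m k} → m % 2 ≡ 1 → k % 2 ≡ 1 → SeriesSumsTo (calJTerm m k) (+ 2 / 3)
  𝒥-odd-odd {m} {k} hm hk = subst (SeriesSumsTo (calJTerm m k)) (cong₂ (λ m k → calJTerm m k 0) hm hk)
    (SeriesSumsTo-calJTerm₀ m k λ v → calJTerm-vanishing m k (suc v) (calJ-vanishing m k (suc v) λ r → Jcard-odd-odd v r hm hk))

  𝒥-odd-even : ∀ {m k} → m % 2 ≡ 1 → k % 2 ≡ 0 → SeriesSumsTo (calJTerm m k) 1ℚ
  𝒥-odd-even {m} {k} hm hk = subst (SeriesSumsTo (calJTerm m k)) (cong₂ (λ m k → calJTerm m k 0) hm hk)
    (SeriesSumsTo-calJTerm₀ m k λ v → calJTerm-even m k v (m%n≡0⇒n∣m k 2 hk))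

  𝒥-even-even : ∀ {m k} → m % 2 ≡ 0 → k % 2 ≡ 0 → SeriesSumsTo (calJTerm m k) (+ 3 / 2)
  𝒥-even-even {m} {k} hm hk = subst (SeriesSumsTo (calJTerm m k)) (cong₂ (λ m k → calJTerm m k 0) hm hk)
    (SeriesSumsTo-calJTerm₀ m k λ v → calJTerm-even m k v (m%n≡0⇒n∣m k 2 hk))

  -- Σ_{v ≥ 3} (14/3) 8^(-v) = 1/96, so the error after the first 3 + n terms is 8^(-n)/96.
  𝒥-even-odd-≡1 : ∀ {m k} → m % 2 ≡ 0 → k % 2 ≡ 1 → k % 8 ≡ 1 → SeriesSumsTo (calJTerm m k) 1ℚ
  𝒥-even-odd-≡1 {m} {k} hm hk k≡1 = SeriesSumsTo-≤⅛^ {calJTerm m k} {1ℚ} 3 λ n →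
    subst (λ y → ℚ.∣ y - 1ℚ ∣ ≤ ⅛^ n) (sym (partial n))
      (∣[s-d*x]-s∣≤x 1ℚ (+ 1 / 96) (⅛^ n) (*≤* (ℤ.+≤+ ℕ.z≤n)) (*≤* (ℤ.+≤+ (ℕ.s≤s ℕ.z≤n))) (0≤⅛^ n))
    where
    term : ∀ w → calJTerm m k (3 ℕ.+ w) ≡ + 14 / 3 * ⅛^ (3 ℕ.+ w)
    term w = trans (calJTerm-coprime m k (3 ℕ.+ w) (2^-coprime (%2≡1⇒2∤ hk) (3 ℕ.+ w)))
                   (cong (_* ⅛^ (3 ℕ.+ w)) (calJ-eight m k (3 ℕ.+ w) hm λ r → Jcard-tail-≡1 w r hm k≡1))
    partial : ∀ n → partialSum (calJTerm m k) (3 ℕ.+ n) ≡ 1ℚ - + 1 / 96 * ⅛^ n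
    partial zero    = trans (partialSum₃-mod32 m k hm hk)
      (partialSum₃-table-≡1 (m%n<n k 32) (trans (m∣n⇒o%n%m≡o%m 8 32 k (divides 4 refl)) k≡1))
    partial (suc n) = begin
      partialSum (calJTerm m k) (3 ℕ.+ n) + calJTerm m k (3 ℕ.+ n)
        ≡⟨ cong₂ _+_ (partial n) (term n) ⟩
      (1ℚ - + 1 / 96 * ⅛^ n) + + 14 / 3 * ⅛^ (3 ℕ.+ n)
        ≡⟨ cong (λ y → (1ℚ - + 1 / 96 * ⅛^ n) + + 14 / 3 * y) ⅛^[3+n] ⟩
      (1ℚ - + 1 / 96 * ⅛^ n) + + 14 / 3 * (+ 1 / 8 * (+ 1 / 8 * (+ 1 / 8 * ⅛^ n)))
        ≡⟨ geometric (⅛^ n) ⟩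
      1ℚ - + 1 / 96 * (+ 1 / 8 * ⅛^ n)
        ≡⟨ cong (λ y → 1ℚ - + 1 / 96 * y) (⅛^-suc n) ⟨
      1ℚ - + 1 / 96 * ⅛^ suc n ∎
      where
      open ≡-Reasoning
      ⅛^[3+n] : ⅛^ (3 ℕ.+ n) ≡ + 1 / 8 * (+ 1 / 8 * (+ 1 / 8 * ⅛^ n))
      ⅛^[3+n] = trans (⅛^-suc (2 ℕ.+ n)) (cong (+ 1 / 8 *_) (trans (⅛^-suc (1 ℕ.+ n)) (cong (+ 1 / 8 *_) (⅛^-suc n))))
      geometric : ∀ x → (1ℚ - + 1 / 96 * x) + + 14 / 3 * (+ 1 / 8 * (+ 1 / 8 * (+ 1 / 8 * x))) ≡ 1ℚ - + 1 / 96 * (+ 1 / 8 * x)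
      geometric = solve 1 (λ x → (con 1ℚ :- con (+ 1 / 96) :* x) :+ con (+ 14 / 3) :* (con (+ 1 / 8) :* (con (+ 1 / 8) :* (con (+ 1 / 8) :* x)))
                              := con 1ℚ :- con (+ 1 / 96) :* (con (+ 1 / 8) :* x)) refl

  𝒥-even-odd-≢1 : ∀ {m k} → m % 2 ≡ 0 → k % 2 ≡ 1 → k % 8 ≢ 1 → SeriesSumsTo (calJTerm m k) 1ℚ
  𝒥-even-odd-≢1 {m} {k} hm hk k≢1 = SeriesSumsTo-const {calJTerm m k} {1ℚ} 3 partial
    where
    partial : ∀ n → partialSum (calJTerm m k) (3 ℕ.+ n) ≡ 1ℚ
    partial zero    = trans (partialSum₃-mod32 m k hm hk) (partialSum₃-table-≢1 (m%n<n k 32)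
      (trans (m∣n⇒o%n%m≡o%m 2 32 k (divides 16 refl)) hk) (k≢1 ∘ trans (sym (m∣n⇒o%n%m≡o%m 8 32 k (divides 4 refl)))))
    partial (suc n) = trans (cong₂ _+_ (partial n) (calJTerm-vanishing m k (3 ℕ.+ n)
      (calJ-vanishing m k (3 ℕ.+ n) λ r → Jcard-tail-≢1 n r hm hk k≢1))) (+-identityʳ 1ℚ)

  𝒥-even-odd : ∀ {m k} → m % 2 ≡ 0 → k % 2 ≡ 1 → SeriesSumsTo (calJTerm m k) 1ℚ
  𝒥-even-odd {k = k} hm hk = [ 𝒥-even-odd-≡1 hm hk , 𝒥-even-odd-≢1 hm hk ]′ (toSum (k % 8 ≟ 1))

open import Defs
open Congruences using (2∤⇒%2≡1)
open Terms using (𝒥-odd-odd; 𝒥-odd-even; 𝒥-even-even; 𝒥-even-odd)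
open import Data.Nat using (ℕ; _*_; _>_)
open import Data.Nat.Divisibility using (_∣_; ∣m⇒∣m*n; ∣n⇒∣m*n; n∣m⇒m%n≡0)
open import Data.Nat.Primality using (euclidsLemma; prime[2])
open import Data.Integer using (+_)
open import Data.Rational using (_/_)
open import Data.Product using (_×_; _,_)
open import Data.Sum using ([_,_]′)
open import Function using (_∘_)
open import Relation.Nullary using (¬_)

lemma7p2 : (m k : ℕ) → m > 0 → k > 0 →
    ((¬ (2 ∣ m * k) → SeriesSumsTo (calJTerm m k) (+ 2 / 3))
    × (2 ∣ m → 2 ∣ k → SeriesSumsTo (calJTerm m k) (+ 3 / 2))
    × (2 ∣ m * k → ¬ (2 ∣ m × 2 ∣ k) → SeriesSumsTo (calJTerm m k) (+ 1 / 1)))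
lemma7p2 m k _ _ = odd-product , both-even , one-even
  where
  odd-product : ¬ (2 ∣ m * k) → SeriesSumsTo (calJTerm m k) (+ 2 / 3)
  odd-product 2∤mk = 𝒥-odd-odd (2∤⇒%2≡1 {m} (2∤mk ∘ ∣m⇒∣m*n k)) (2∤⇒%2≡1 {k} (2∤mk ∘ ∣n⇒∣m*n m))
  both-even : 2 ∣ m → 2 ∣ k → SeriesSumsTo (calJTerm m k) (+ 3 / 2)
  both-even 2∣m 2∣k = 𝒥-even-even (n∣m⇒m%n≡0 m 2 2∣m) (n∣m⇒m%n≡0 k 2 2∣k)
  one-even : 2 ∣ m * k → ¬ (2 ∣ m × 2 ∣ k) → SeriesSumsTo (calJTerm m k) (+ 1 / 1)
  one-even 2∣mk not-both = [ (λ 2∣m → 𝒥-even-odd (n∣m⇒m%n≡0 m 2 2∣m) (2∤⇒%2≡1 (λ 2∣k → not-both (2∣m , 2∣k))))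
                           , (λ 2∣k → 𝒥-odd-even (2∤⇒%2≡1 (λ 2∣m → not-both (2∣m , 2∣k))) (n∣m⇒m%n≡0 k 2 2∣k))
                           ]′ (euclidsLemma m k prime[2] 2∣mk)
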